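{- Let $P$ be a row-finite matrix with entries in a partially ordered commutative ring $R$, and let $A=\mathcal{O}(P)$. Fix $1\le r\le\infty$. (a) If $P$ is totally positive of order $r$, then so is $A$. (b) If the matrix $B_x^{ -1}PB_x$ is totally positive of order $r$ in the ring $R[x]$ equipped with the coefficientwise order, then the sequence $(A_n(x))_{n\ge0}$ of row-generating polynomials of $A$ is Hankel-totally positive of order $r$ in $R[x]$ equipped with the coefficientwise order.
   Context: A partially ordered commutative ring is a commutative ring $R$ with a subset $\mathcal{P}$ of nonnegative elements satisfying $0,1\in\mathcal{P}$, closure under $+$ and $\cdot$, and $\mathcal{P}\cap(-\mathcal{P})=\{0\}$; the coefficientwise order on $R[x]$ takes as nonnegative the polynomials with all coefficients in $\mathcal{P}$. A matrix is totally positive of order $r$ if all its minors of size $\le r$ are nonnegative; a sequence $(a_n)$ is Hankel-TP of order $r$ if $(a_{i+j})_{i,j\ge0}$ is. A matrix is row-finite if each row has finitely many nonzero entries. For a row-finite $P=(p_{ij})_{i,j\ge0}$, the output matrix $\mathcal{O}(P)=(a_{nk})_{n,k\ge0}$ is $a_{nk}=(P^n)_{0k}$. Its row-generating polynomials are $A_n(x)=\sum_k a_{nk}x^k$. $B_x$ is the matrix with entries $(B_x)_{ij}=\binom{i}{j}x^{i-j}$ (inverse $(B_x^{ -1})_{ij}=\binom{i}{j}(-x)^{i-j}$). -}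

module Defs where

open import Level using (Level; _⊔_) renaming (suc to lsuc)
open import Data.Nat using (ℕ; zero; suc; _≤_; _<_; _∸_; _≤?_) renaming (_⊔_ to _⊔ℕ_)
import Data.Nat
open import Data.Nat.Combinatorics using (_C_)
open import Data.Fin using (Fin; punchIn; toℕ) renaming (zero to fzero; suc to fsuc; _<_ to _<ᶠ_)
open import Data.List using (List; []; _∷_; map; replicate; _++_; upTo)
open import Data.List.Relation.Unary.All using (All)
open import Data.Product using (_×_)
open import Data.Unit using (⊤)
open import Relation.Nullary using (yes; no)
open import Algebra.Bundles using (CommutativeRing)
open import Algebra.Bundles.Raw using (RawRing)

record POCommRing (c ℓ p : Level) : Set (lsuc (c ⊔ ℓ ⊔ p)) where
  field
    commRing : CommutativeRing c ℓ
  open CommutativeRing commRing public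
  field
    Nonneg      : Carrier → Set p
    Nonneg-resp : ∀ {x y} → x ≈ y → Nonneg x → Nonneg y
    Nonneg-0    : Nonneg 0#
    Nonneg-1    : Nonneg 1#
    Nonneg-+    : ∀ {x y} → Nonneg x → Nonneg y → Nonneg (x + y)
    Nonneg-*    : ∀ {x y} → Nonneg x → Nonneg y → Nonneg (x * y)
    Nonneg-anti : ∀ {x} → Nonneg x → Nonneg (- x) → x ≈ 0#

module RawOps {c ℓ : Level} (RR : RawRing c ℓ) where
  open RawRing RR

  sumRange : ℕ → (ℕ → Carrier) → Carrier
  sumRange zero    f = 0#
  sumRange (suc n) f = sumRange n f + f n

  sumFin : ∀ {n} → (Fin n → Carrier) → Carrier
  sumFin {zero}  f = 0#
  sumFin {suc n} f = f fzero + sumFin (λ i → f (fsuc i))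

  sgn : ℕ → Carrier
  sgn zero    = 1#
  sgn (suc n) = - sgn n

  fromℕ : ℕ → Carrier
  fromℕ zero    = 0#
  fromℕ (suc n) = 1# + fromℕ n

  det : ∀ k → (Fin k → Fin k → Carrier) → Carrier
  det zero    M = 1#
  det (suc k) M =
    sumFin (λ j → sgn (toℕ j) * M fzero j
                    * det k (λ a b → M (fsuc a) (punchIn j b)))

  -- product of infinite matrices, where b i bounds the support of row i of M
  mulM : (ℕ → ℕ) → (ℕ → ℕ → Carrier) → (ℕ → ℕ → Carrier) → (ℕ → ℕ → Carrier)
  mulM b M N i j = sumRange (b i) (λ k → M i k * N k j)

data Order : Set where
  fin : ℕ → Order
  ∞   : Order

_≤ᵒ_ : ℕ → Order → Set
k ≤ᵒ fin r = k ≤ r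
k ≤ᵒ ∞     = ⊤

StrictlyIncreasing : ∀ {k} → (Fin k → ℕ) → Set
StrictlyIncreasing f = ∀ a b → a <ᶠ b → f a < f b

TP : ∀ {c ℓ p} (RR : RawRing c ℓ) → (RawRing.Carrier RR → Set p) →
     Order → (ℕ → ℕ → RawRing.Carrier RR) → Set p
TP RR Nonneg r M =
  ∀ k → 1 ≤ k → k ≤ᵒ r → (rows cols : Fin k → ℕ) →
  StrictlyIncreasing rows → StrictlyIncreasing cols →
  Nonneg (RawOps.det RR k (λ a b → M (rows a) (cols b)))

HankelTP : ∀ {c ℓ p} (RR : RawRing c ℓ) → (RawRing.Carrier RR → Set p) →
           Order → (ℕ → RawRing.Carrier RR) → Set p
HankelTP RR Nonneg r a = TP RR Nonneg r (λ i j → a (i Data.Nat.+ j))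

module _ {c ℓ p : Level} (R : POCommRing c ℓ p) where
  open POCommRing R
  open RawOps rawRing

  record RowFinite (M : ℕ → ℕ → Carrier) : Set (c ⊔ ℓ) where
    field
      bound  : ℕ → ℕ
      vanish : ∀ i j → bound i ≤ j → M i j ≈ 0#

  idM : ℕ → ℕ → Carrier
  idM zero    zero    = 1#
  idM zero    (suc j) = 0#
  idM (suc i) zero    = 0#
  idM (suc i) (suc j) = idM i j

  maxRange : ℕ → (ℕ → ℕ) → ℕ
  maxRange zero    f = 0
  maxRange (suc n) f = maxRange n f ⊔ℕ f n

  module _ (P : ℕ → ℕ → Carrier) (rf : RowFinite P) where
    open RowFinite rf

    -- bound on the support of row i of P^n
    powBound : ℕ → ℕ → ℕ
    powBound zero    i = suc i
    powBound (suc n) i = maxRange (powBound n i) bound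

    powM : ℕ → ℕ → ℕ → Carrier
    powM zero    = idM
    powM (suc n) = mulM (powBound n) (powM n) P

    outputMatrix : ℕ → ℕ → Carrier
    outputMatrix n k = powM n 0 k

  -- Polynomials R[x] as coefficient lists (constant term first)

  Poly : Set c
  Poly = List Carrier

  coeff : Poly → ℕ → Carrier
  coeff []       n       = 0#
  coeff (a ∷ p)  zero    = a
  coeff (a ∷ p)  (suc n) = coeff p n

  addP : Poly → Poly → Poly
  addP []      q       = q
  addP (a ∷ p) []      = a ∷ p
  addP (a ∷ p) (b ∷ q) = (a + b) ∷ addP p q

  mulP : Poly → Poly → Poly
  mulP []      q = []
  mulP (a ∷ p) q = addP (map (a *_) q) (0# ∷ mulP p q)

  polyRawRing : RawRing c ℓ
  polyRawRing = record
    { Carrier = Poly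
    ; _≈_     = λ p q → ∀ n → coeff p n ≈ coeff q n
    ; _+_     = addP
    ; _*_     = mulP
    ; -_      = map (-_)
    ; 0#      = []
    ; 1#      = 1# ∷ []
    }

  NonnegPoly : Poly → Set (c ⊔ p)
  NonnegPoly = All Nonneg

  const : Carrier → Poly
  const a = a ∷ []

  monomial : ℕ → Carrier → Poly
  monomial n a = replicate n 0# ++ (a ∷ [])

  Bx : ℕ → ℕ → Poly
  Bx i j with j ≤? i
  ... | yes _ = monomial (i ∸ j) (fromℕ (i C j))
  ... | no  _ = []

  BxInv : ℕ → ℕ → Poly
  BxInv i j with j ≤? i
  ... | yes _ = monomial (i ∸ j) (sgn (i ∸ j) * fromℕ (i C j))
  ... | no  _ = []

  module _ (P : ℕ → ℕ → Carrier) (rf : RowFinite P) where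
    open RowFinite rf
    open RawOps polyRawRing using () renaming (mulM to mulMP)

    conjByBx : ℕ → ℕ → Poly
    conjByBx = mulMP suc BxInv (mulMP bound (λ i j → const (P i j)) Bx)

    rowPoly : ℕ → Poly
    rowPoly n = map (outputMatrix P rf n) (upTo (powBound P rf n 0))

{-# OPTIONS --safe #-}
module Submission where

-- (a) Row 0 of A = O(P) is e₀ and row n+1 of A is row n times P.  A minor of A
-- that uses row 0 either vanishes or, after expanding along that row, is a
-- smaller minor of the same kind; a minor avoiding row 0 is, by the
-- Cauchy–Binet formula, a sum of products of minors of A (one row lower) and
-- minors of P.  Induction on the largest row index gives total positivity.
-- (b) Put Q = B_x⁻¹ P B_x.  Then A B_x is the output matrix of Q and its column 0
-- is (A_n(x))ₙ, so A_{n+m}(x) = (Q^{n+m})₀₀ = Σ_k (Q^n)₀ₖ (Q^m)ₖ₀: the Hankel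
-- matrix is the product of A B_x and V = ((Q^m)ₖ₀)_{k,m}.  The argument of (a)
-- shows that both factors are totally positive of order r, and Cauchy–Binet
-- finishes the proof.

open import Defs
open import Level using (Level; _⊔_)
open import Data.Nat as ℕ using (ℕ; zero; suc; _∸_)
import Data.Nat.Properties as ℕP
open import Data.Fin using (Fin; punchIn; toℕ) renaming (zero to fzero; suc to fsuc)
open import Data.List using ([]; _∷_; map)
open import Data.Product using (_×_; _,_; proj₁; proj₂)
open import Data.Sum using (inj₁; inj₂)
open import Data.Unit using (tt)
open import Data.Empty using (⊥-elim)
open import Function using (_∘_)
open import Relation.Nullary using (yes; no; ¬_; Dec)
import Relation.Binary.PropositionalEquality as P
open import Algebra.Bundles using (CommutativeRing)

infixr 5 _∷ᵗ_
_∷ᵗ_ : ∀ {k} → ℕ → (Fin k → ℕ) → Fin (suc k) → ℕ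
(x ∷ᵗ f) fzero = x
(x ∷ᵗ f) (fsuc i) = f i

nilᵗ : Fin 0 → ℕ
nilᵗ ()

maxFin : ∀ {k} → (Fin k → ℕ) → ℕ
maxFin {zero} f = 0
maxFin {suc k} f = f fzero ℕ.⊔ maxFin (f ∘ fsuc)

maxFin-≤ : ∀ {k} (f : Fin k → ℕ) a → f a ℕ.≤ maxFin f
maxFin-≤ f fzero = ℕP.m≤m⊔n _ _
maxFin-≤ f (fsuc a) = ℕP.≤-trans (maxFin-≤ (f ∘ fsuc) a) (ℕP.m≤n⊔m _ _)

SI : ∀ {k} → (Fin k → ℕ) → Set
SI = StrictlyIncreasing

SI-tail : ∀ {k} {T : Fin (suc k) → ℕ} → SI T → SI (T ∘ fsuc)
SI-tail s a b a<b = s (fsuc a) (fsuc b) (ℕ.s≤s a<b)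

SI-0< : ∀ {k} {T : Fin (suc k) → ℕ} → SI T → ∀ b → T fzero ℕ.< T (fsuc b)
SI-0< s b = s fzero (fsuc b) (ℕ.s≤s ℕ.z≤n)

SI-0≤ : ∀ {k} {T : Fin (suc k) → ℕ} → SI T → ∀ a → T fzero ℕ.≤ T a
SI-0≤ s fzero = ℕP.≤-refl
SI-0≤ s (fsuc b) = ℕP.<⇒≤ (SI-0< s b)

SI-cons : ∀ {k} {T : Fin k → ℕ} → SI T → SI (0 ∷ᵗ suc ∘ T)
SI-cons s fzero fzero ()
SI-cons s fzero (fsuc b) _ = ℕ.s≤s ℕ.z≤n
SI-cons s (fsuc a) fzero ()
SI-cons s (fsuc a) (fsuc b) (ℕ.s≤s a<b) = ℕ.s≤s (s a b a<b)

SI-suc : ∀ {k} {T : Fin k → ℕ} → SI T → SI (suc ∘ T)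
SI-suc s a b a<b = ℕ.s≤s (s a b a<b)

SI-pred : ∀ {k} {T : Fin k → ℕ} → (∀ a → 1 ℕ.≤ T a) → SI T → SI (ℕ.pred ∘ T)
SI-pred {T = T} pos s a b a<b with T a | T b | pos a | pos b | s a b a<b
... | suc x | suc y | _ | _ | ℕ.s≤s lt = lt

≤ᵒ-pred : ∀ {k r} → suc k ≤ᵒ r → k ≤ᵒ r
≤ᵒ-pred {k} {fin r} h = ℕP.≤-trans (ℕP.n≤1+n k) h
≤ᵒ-pred {k} {∞} h = tt

suc-pred : ∀ {n} → 1 ℕ.≤ n → n P.≡ suc (ℕ.pred n)
suc-pred {suc n} _ = P.refl

SI-positive : ∀ {k} {T : Fin (suc k) → ℕ} {t} → SI T → T fzero P.≡ suc t → ∀ a → 1 ℕ.≤ T a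
SI-positive {T = T} s e a = ℕP.≤-trans (P.subst (1 ℕ.≤_) (P.sym e) (ℕ.s≤s ℕ.z≤n)) (SI-0≤ s a)

module Determinants {c ℓ} (CR : CommutativeRing c ℓ) where

  open CommutativeRing CR hiding (zero)
  open RawOps rawRing public
  open import Algebra.Properties.Ring ring using (-‿involutive; -‿distribˡ-*; -‿distribʳ-*)
  import Algebra.Properties.CommutativeSemigroup as CSP
  module *P = CSP *-commutativeSemigroup
  module +P = CSP +-commutativeSemigroup
  open import Algebra.Solver.CommutativeMonoid *-commutativeMonoid using (solve; _⊕_; _⊜_)
  open import Relation.Binary.Reasoning.Setoid setoid

  sgn*sgn≈1 : ∀ n → sgn n * sgn n ≈ 1#
  sgn*sgn≈1 zero = *-identityˡ 1#
  sgn*sgn≈1 (suc n) = begin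
    - sgn n * - sgn n ≈⟨ sym (-‿distribˡ-* (sgn n) (- sgn n)) ⟩
    - (sgn n * - sgn n) ≈⟨ -‿cong (sym (-‿distribʳ-* (sgn n) (sgn n))) ⟩
    - (- (sgn n * sgn n)) ≈⟨ -‿involutive _ ⟩
    sgn n * sgn n ≈⟨ sgn*sgn≈1 n ⟩
    1# ∎

  sgn*-cancel : ∀ n {x} → sgn n * x ≈ 0# → x ≈ 0#
  sgn*-cancel n {x} e = begin
    x ≈⟨ sym (*-identityˡ x) ⟩
    1# * x ≈⟨ *-congʳ (sym (sgn*sgn≈1 n)) ⟩
    sgn n * sgn n * x ≈⟨ *-assoc _ _ _ ⟩
    sgn n * (sgn n * x) ≈⟨ *-congˡ e ⟩
    sgn n * 0# ≈⟨ zeroʳ _ ⟩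
    0# ∎

  record IsLinearSum {I : Set} (S : (I → Carrier) → Carrier) : Set (c ⊔ ℓ) where
    field
      ∑-cong : ∀ {f g} → (∀ i → f i ≈ g i) → S f ≈ S g
      ∑-+ : ∀ f g → S (λ i → f i + g i) ≈ S f + S g
      ∑-zero : ∀ f → (∀ i → f i ≈ 0#) → S f ≈ 0#
      *-∑ : ∀ a f → a * S f ≈ S (λ i → a * f i)
  open IsLinearSum public

  sumFin-linear : ∀ n → IsLinearSum (sumFin {n})
  sumFin-linear n = record { ∑-cong = sum-cong n ; ∑-+ = sum-+ n ; ∑-zero = sum-zero n ; *-∑ = *-sum n }
    where
    sum-cong : ∀ n {f g} → (∀ i → f i ≈ g i) → sumFin {n} f ≈ sumFin g
    sum-cong zero e = refl
    sum-cong (suc n) e = +-cong (e fzero) (sum-cong n (λ i → e (fsuc i)))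
    sum-+ : ∀ n f g → sumFin {n} (λ i → f i + g i) ≈ sumFin f + sumFin g
    sum-+ zero f g = sym (+-identityˡ 0#)
    sum-+ (suc n) f g = trans (+-congˡ (sum-+ n _ _)) (+P.interchange _ _ _ _)
    sum-zero : ∀ n f → (∀ i → f i ≈ 0#) → sumFin {n} f ≈ 0#
    sum-zero zero f e = refl
    sum-zero (suc n) f e = trans (+-cong (e fzero) (sum-zero n _ (λ i → e (fsuc i)))) (+-identityˡ 0#)
    *-sum : ∀ n a f → a * sumFin {n} f ≈ sumFin (λ i → a * f i)
    *-sum zero a f = zeroʳ a
    *-sum (suc n) a f = trans (distribˡ _ _ _) (+-congˡ (*-sum n a _))

  sumRange-linear : ∀ n → IsLinearSum (sumRange n)
  sumRange-linear n = record { ∑-cong = sum-cong n ; ∑-+ = sum-+ n ; ∑-zero = sum-zero n ; *-∑ = *-sum n }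
    where
    sum-cong : ∀ n {f g} → (∀ i → f i ≈ g i) → sumRange n f ≈ sumRange n g
    sum-cong zero e = refl
    sum-cong (suc n) e = +-cong (sum-cong n e) (e n)
    sum-+ : ∀ n f g → sumRange n (λ i → f i + g i) ≈ sumRange n f + sumRange n g
    sum-+ zero f g = sym (+-identityˡ 0#)
    sum-+ (suc n) f g = trans (+-congʳ (sum-+ n _ _)) (+P.interchange _ _ _ _)
    sum-zero : ∀ n f → (∀ i → f i ≈ 0#) → sumRange n f ≈ 0#
    sum-zero zero f e = refl
    sum-zero (suc n) f e = trans (+-cong (sum-zero n _ e) (e n)) (+-identityˡ 0#)
    *-sum : ∀ n a f → a * sumRange n f ≈ sumRange n (λ i → a * f i)
    *-sum zero a f = zeroʳ a
    *-sum (suc n) a f = trans (distribˡ _ _ _) (+-congʳ (*-sum n a _))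

  sumFin-exchange : ∀ n {I : Set} {S : (I → Carrier) → Carrier} → IsLinearSum S →
    ∀ (F : Fin n → I → Carrier) →
    sumFin (λ i → S (F i)) ≈ S (λ x → sumFin (λ i → F i x))
  sumFin-exchange zero A F = sym (∑-zero A _ (λ _ → refl))
  sumFin-exchange (suc n) A F =
    trans (+-congˡ (sumFin-exchange n A (λ i → F (fsuc i)))) (sym (∑-+ A _ _))

  sumRange-exchange : ∀ n {I : Set} {S : (I → Carrier) → Carrier} → IsLinearSum S →
    ∀ (F : ℕ → I → Carrier) →
    sumRange n (λ i → S (F i)) ≈ S (λ x → sumRange n (λ i → F i x))
  sumRange-exchange zero A F = sym (∑-zero A _ (λ _ → refl))
  sumRange-exchange (suc n) A F =
    trans (+-congʳ (sumRange-exchange n A F)) (sym (∑-+ A _ _))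

  sumRange-sucˡ : ∀ n f → sumRange (suc n) f ≈ f 0 + sumRange n (f ∘ suc)
  sumRange-sucˡ zero f = trans (+-identityˡ _) (sym (+-identityʳ _))
  sumRange-sucˡ (suc n) f = begin
    sumRange (suc n) f + f (suc n) ≈⟨ +-congʳ (sumRange-sucˡ n f) ⟩
    (f 0 + sumRange n (f ∘ suc)) + f (suc n) ≈⟨ +-assoc _ _ _ ⟩
    f 0 + sumRange (suc n) (f ∘ suc) ∎

  sumRange-*ʳ : ∀ n f c → sumRange n f * c ≈ sumRange n (λ i → f i * c)
  sumRange-*ʳ n f c = trans (*-comm _ _) (trans (*-∑ (sumRange-linear n) c f) (∑-cong (sumRange-linear n) (λ i → *-comm c (f i))))

  sumRange-cong< : ∀ n {f g} → (∀ i → i ℕ.< n → f i ≈ g i) → sumRange n f ≈ sumRange n g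
  sumRange-cong< zero e = refl
  sumRange-cong< (suc n) e = +-cong (sumRange-cong< n (λ i i<n → e i (ℕP.m<n⇒m<1+n i<n))) (e n ℕP.≤-refl)

  sumRange-pad : ∀ n m f → (∀ i → n ℕ.≤ i → f i ≈ 0#) → sumRange n f ≈ sumRange (n ℕ.+ m) f
  sumRange-pad n zero f z = P.subst (λ t → sumRange n f ≈ sumRange t f) (P.sym (ℕP.+-identityʳ n)) refl
  sumRange-pad n (suc m) f z = begin
    sumRange n f ≈⟨ sumRange-pad n m f z ⟩
    sumRange (n ℕ.+ m) f ≈⟨ sym (+-identityʳ _) ⟩
    sumRange (n ℕ.+ m) f + 0# ≈⟨ +-congˡ (sym (z (n ℕ.+ m) (ℕP.m≤m+n n m))) ⟩
    sumRange (suc (n ℕ.+ m)) f ≡⟨ P.cong (λ t → sumRange t f) (P.sym (ℕP.+-suc n m)) ⟩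
    sumRange (n ℕ.+ suc m) f ∎

  sumRange-pad≤ : ∀ {n m} f → n ℕ.≤ m → (∀ i → n ℕ.≤ i → f i ≈ 0#) → sumRange n f ≈ sumRange m f
  sumRange-pad≤ {n} {m} f n≤m z with ℕP.m≤n⇒∃[o]m+o≡n n≤m
  ... | o , P.refl = sumRange-pad n o f z

  sumRange-zero< : ∀ n f → (∀ i → i ℕ.< n → f i ≈ 0#) → sumRange n f ≈ 0#
  sumRange-zero< n f h = trans (sumRange-cong< n {g = λ _ → 0#} h) (∑-zero (sumRange-linear n) (λ _ → 0#) (λ _ → refl))

  δ : ℕ → ℕ → Carrier
  δ zero zero = 1#
  δ zero (suc j) = 0#
  δ (suc i) zero = 0#
  δ (suc i) (suc j) = δ i j

  δ-below : ∀ l i → i ℕ.< l → δ l i ≈ 0#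
  δ-below (suc l) zero _ = refl
  δ-below (suc l) (suc i) (ℕ.s≤s lt) = δ-below l i lt

  δ-diagonal : ∀ l → δ l l ≈ 1#
  δ-diagonal zero = refl
  δ-diagonal (suc l) = δ-diagonal l

  sumRange-δ : ∀ l (V : ℕ → Carrier) → sumRange (suc l) (λ i → δ l i * V i) ≈ V l
  sumRange-δ l V = trans (+-cong (sumRange-zero< l (λ i → δ l i * V i) (λ i i<l → trans (*-congʳ (δ-below l i i<l)) (zeroˡ _)))
                            (trans (*-congʳ (δ-diagonal l)) (*-identityˡ _))) (+-identityˡ _)

  -- Sum of F T over the strictly increasing k-tuples T with entries below N.
  sumInc : ∀ k → ℕ → ((Fin k → ℕ) → Carrier) → Carrier
  sumInc zero N F = F nilᵗ
  sumInc (suc k) zero F = 0#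
  sumInc (suc k) (suc N) F =
    sumInc k N (λ T → F (0 ∷ᵗ (suc ∘ T))) + sumInc (suc k) N (λ T → F (suc ∘ T))

  sumInc-linear : ∀ k N → IsLinearSum (sumInc k N)
  sumInc-linear k N = record { ∑-cong = sum-cong k N ; ∑-+ = sum-+ k N ; ∑-zero = sum-zero k N ; *-∑ = *-sum k N }
    where
    sum-cong : ∀ k N {f g} → (∀ i → f i ≈ g i) → sumInc k N f ≈ sumInc k N g
    sum-cong zero N e = e _
    sum-cong (suc k) zero e = refl
    sum-cong (suc k) (suc N) e = +-cong (sum-cong k N (λ i → e _)) (sum-cong (suc k) N (λ i → e _))
    sum-+ : ∀ k N f g → sumInc k N (λ i → f i + g i) ≈ sumInc k N f + sumInc k N g
    sum-+ zero N f g = refl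
    sum-+ (suc k) zero f g = sym (+-identityˡ 0#)
    sum-+ (suc k) (suc N) f g = trans (+-cong (sum-+ k N _ _) (sum-+ (suc k) N _ _)) (+P.interchange _ _ _ _)
    sum-zero : ∀ k N f → (∀ i → f i ≈ 0#) → sumInc k N f ≈ 0#
    sum-zero zero N f e = e _
    sum-zero (suc k) zero f e = refl
    sum-zero (suc k) (suc N) f e = trans (+-cong (sum-zero k N _ (λ i → e _)) (sum-zero (suc k) N _ (λ i → e _))) (+-identityˡ 0#)
    *-sum : ∀ k N a f → a * sumInc k N f ≈ sumInc k N (λ i → a * f i)
    *-sum zero N a f = refl
    *-sum (suc k) zero a f = zeroʳ a
    *-sum (suc k) (suc N) a f = trans (distribˡ _ _ _) (+-cong (*-sum k N a _) (*-sum (suc k) N a _))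

  Respects≗ : ∀ {k} → ((Fin k → ℕ) → Carrier) → Set ℓ
  Respects≗ {k} F = ∀ {T T' : Fin k → ℕ} → (∀ a → T a P.≡ T' a) → F T ≈ F T'

  -- A pair (l , T) with l ∉ T is the same as the increasing tuple U = T ∪ {l}
  -- together with the position m of l in U.
  sumRange-sumInc-merge : ∀ N k (G : ℕ → (Fin k → ℕ) → Carrier) →
    (∀ l → Respects≗ (G l)) →
    (∀ l T a → T a P.≡ l → G l T ≈ 0#) →
    sumRange N (λ l → sumInc k N (G l)) ≈
    sumInc (suc k) N (λ U → sumFin (λ m → G (U m) (U ∘ punchIn m)))
  sumRange-sumInc-merge zero k G G-resp G-vanishes = refl
  sumRange-sumInc-merge (suc N) zero G G-resp G-vanishes = begin
    sumRange (suc N) (λ l → G l nilᵗ) ≈⟨ sumRange-sucˡ N _ ⟩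
    G 0 nilᵗ + sumRange N (λ l → G (suc l) nilᵗ)
      ≈⟨ +-cong (sym (trans (+-identityʳ _) (G-resp 0 (λ ())))) (trans (∑-cong (sumRange-linear N) (λ l → G-resp (suc l) (λ ())))
           (sumRange-sumInc-merge N zero (λ l T → G (suc l) (suc ∘ T)) (λ l e → G-resp (suc l) (λ a → P.cong suc (e a)))
                (λ l T a e → G-vanishes (suc l) (suc ∘ T) a (P.cong suc e)))) ⟩
    _ ∎
  sumRange-sumInc-merge (suc N) (suc k) G G-resp G-vanishes = begin
    sumRange (suc N) (λ l → B l + C l) ≈⟨ sumRange-sucˡ N _ ⟩
    (B 0 + C 0) + sumRange N (λ l → B (suc l) + C (suc l))
      ≈⟨ +-cong (trans (+-congʳ (∑-zero (sumInc-linear k N) _ (λ T → G-vanishes 0 _ fzero P.refl))) (+-identityˡ _))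
                (∑-+ (sumRange-linear N) _ _) ⟩
    C 0 + (sumRange N (λ l → B (suc l)) + sumRange N (λ l → C (suc l))) ≈⟨ sym (+-assoc _ _ _) ⟩
    (C 0 + sumRange N (λ l → B (suc l))) + sumRange N (λ l → C (suc l))
      ≈⟨ +-cong (+-congˡ (sumRange-sumInc-merge N k G₁ (λ l e → G-resp (suc l) (cons-resp e)) G₁-vanishes))
                (sumRange-sumInc-merge N (suc k) G₂ (λ l e → G-resp (suc l) (λ a → P.cong suc (e a))) G₂-vanishes) ⟩
    (C 0 + sumInc (suc k) N (λ U → sumFin (λ m → G₁ (U m) (U ∘ punchIn m))))
      + sumInc (suc (suc k)) N (λ U → H (suc ∘ U))
      ≈⟨ +-congʳ (trans (sym (∑-+ (sumInc-linear (suc k) N) _ _))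
                  (∑-cong (sumInc-linear (suc k) N) (λ U → +-cong (G-resp 0 (λ a → P.refl))
                     (∑-cong (sumFin-linear (suc k)) (λ m → G-resp (suc (U m)) (cons-punchIn U m)))))) ⟩
    sumInc (suc k) N (λ U → H (0 ∷ᵗ (suc ∘ U))) + sumInc (suc (suc k)) N (λ U → H (suc ∘ U)) ∎
    where
    B = λ l → sumInc k N (λ T → G l (0 ∷ᵗ (suc ∘ T)))
    C = λ l → sumInc (suc k) N (λ T → G l (suc ∘ T))
    H = λ (U : Fin (suc (suc k)) → ℕ) → sumFin (λ m → G (U m) (U ∘ punchIn m))
    G₁ = λ l T → G (suc l) (0 ∷ᵗ (suc ∘ T))
    G₂ = λ l T → G (suc l) (suc ∘ T)
    cons-resp : ∀ {T T' : Fin k → ℕ} → (∀ a → T a P.≡ T' a) → ∀ a → (0 ∷ᵗ suc ∘ T) a P.≡ (0 ∷ᵗ suc ∘ T') a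
    cons-resp e fzero = P.refl
    cons-resp e (fsuc a) = P.cong suc (e a)
    G₁-vanishes : ∀ l T a → T a P.≡ l → G₁ l T ≈ 0#
    G₁-vanishes l T a e = G-vanishes (suc l) _ (fsuc a) (P.cong suc e)
    G₂-vanishes : ∀ l T a → T a P.≡ l → G₂ l T ≈ 0#
    G₂-vanishes l T a e = G-vanishes (suc l) _ a (P.cong suc e)
    cons-punchIn : ∀ (U : Fin (suc k) → ℕ) m a → (0 ∷ᵗ suc ∘ (U ∘ punchIn m)) a P.≡ ((0 ∷ᵗ suc ∘ U) ∘ punchIn (fsuc m)) a
    cons-punchIn U m fzero = P.refl
    cons-punchIn U m (fsuc a) = P.refl

  det-cong : ∀ k {M N : Fin k → Fin k → Carrier} → (∀ a b → M a b ≈ N a b) → det k M ≈ det k N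
  det-cong zero e = refl
  det-cong (suc k) {M} {N} e = ∑-cong (sumFin-linear (suc k)) (λ j →
    *-cong (*-congˡ {sgn (toℕ j)} (e fzero j)) (det-cong k {λ a b → M (fsuc a) (punchIn j b)} {λ a b → N (fsuc a) (punchIn j b)} (λ a b → e (fsuc a) (punchIn j b))))

  -x*-y≈x*y : ∀ x y → (- x) * (- y) ≈ x * y
  -x*-y≈x*y x y = begin
    (- x) * (- y) ≈⟨ sym (-‿distribˡ-* x (- y)) ⟩
    - (x * - y) ≈⟨ -‿cong (sym (-‿distribʳ-* x y)) ⟩
    - (- (x * y)) ≈⟨ -‿involutive _ ⟩
    x * y ∎

  -- (j , j') stands for column j in row 0 and column punchIn j j' in row 1;
  -- swapPick exchanges the two columns, which flips the sign of the term.
  swapPick : ∀ {k} → Fin (suc (suc k)) → Fin (suc k) → Fin (suc (suc k)) × Fin (suc k)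
  swapPick fzero j' = fsuc j' , fzero
  swapPick (fsuc i) fzero = fzero , i
  swapPick {zero} (fsuc i) (fsuc ())
  swapPick {suc k} (fsuc i) (fsuc i') = fsuc (proj₁ (swapPick i i')) , fsuc (proj₂ (swapPick i i'))

  swapPick-fst : ∀ {k} (j : Fin (suc (suc k))) j' → proj₁ (swapPick j j') P.≡ punchIn j j'
  swapPick-fst fzero j' = P.refl
  swapPick-fst (fsuc i) fzero = P.refl
  swapPick-fst {zero} (fsuc i) (fsuc ())
  swapPick-fst {suc k} (fsuc i) (fsuc i') = P.cong fsuc (swapPick-fst i i')

  swapPick-snd : ∀ {k} (j : Fin (suc (suc k))) j' → punchIn (proj₁ (swapPick j j')) (proj₂ (swapPick j j')) P.≡ j
  swapPick-snd fzero j' = P.refl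
  swapPick-snd (fsuc i) fzero = P.refl
  swapPick-snd {zero} (fsuc i) (fsuc ())
  swapPick-snd {suc k} (fsuc i) (fsuc i') = P.cong fsuc (swapPick-snd i i')

  swapPick-punchIn : ∀ {k} (j : Fin (suc (suc k))) j' b →
    punchIn j (punchIn j' b) P.≡ punchIn (proj₁ (swapPick j j')) (punchIn (proj₂ (swapPick j j')) b)
  swapPick-punchIn fzero j' b = P.refl
  swapPick-punchIn (fsuc i) fzero b = P.refl
  swapPick-punchIn {zero} (fsuc i) (fsuc ()) b
  swapPick-punchIn {suc k} (fsuc i) (fsuc i') fzero = P.refl
  swapPick-punchIn {suc k} (fsuc i) (fsuc i') (fsuc b) = P.cong fsuc (swapPick-punchIn i i' b)

  swapPick-sgn : ∀ {k} (j : Fin (suc (suc k))) j' →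
    sgn (toℕ (proj₁ (swapPick j j'))) * sgn (toℕ (proj₂ (swapPick j j'))) ≈ - (sgn (toℕ j) * sgn (toℕ j'))
  swapPick-sgn fzero j' = trans (*-identityʳ _) (-‿cong (sym (*-identityˡ _)))
  swapPick-sgn (fsuc i) fzero = trans (*-identityˡ _) (sym (trans (-‿cong (*-identityʳ _)) (-‿involutive _)))
  swapPick-sgn {zero} (fsuc i) (fsuc ())
  swapPick-sgn {suc k} (fsuc i) (fsuc i') =
    trans (-x*-y≈x*y _ _) (trans (swapPick-sgn i i') (-‿cong (sym (-x*-y≈x*y _ _))))

  sumFin²-antisymmetric : ∀ k (F : Fin (suc (suc k)) → Fin (suc k) → Carrier) →
    (∀ j j' → F (proj₁ (swapPick j j')) (proj₂ (swapPick j j')) + F j j' ≈ 0#) →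
    sumFin (λ j → sumFin (λ j' → F j j')) ≈ 0#
  sumFin²-antisymmetric k F h = begin
    sumFin (λ j' → F fzero j') + sumFin (λ i → F (fsuc i) fzero + sumFin (λ i' → F (fsuc i) (fsuc i')))
      ≈⟨ +-congˡ (∑-+ (sumFin-linear (suc k)) (λ i → F (fsuc i) fzero) (λ i → sumFin (λ i' → F (fsuc i) (fsuc i')))) ⟩
    sumFin (λ j' → F fzero j') + (sumFin (λ i → F (fsuc i) fzero) + sumFin (λ i → sumFin (λ i' → F (fsuc i) (fsuc i'))))
      ≈⟨ sym (+-assoc _ _ _) ⟩
    (sumFin (λ j' → F fzero j') + sumFin (λ i → F (fsuc i) fzero)) + sumFin (λ i → sumFin (λ i' → F (fsuc i) (fsuc i')))
      ≈⟨ +-cong (trans (sym (∑-+ (sumFin-linear (suc k)) (λ j' → F fzero j') (λ i → F (fsuc i) fzero)))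
                       (∑-zero (sumFin-linear (suc k)) (λ j' → F fzero j' + F (fsuc j') fzero) (λ j' → trans (+-comm _ _) (h fzero j'))))
                (rest k F h) ⟩
    0# + 0# ≈⟨ +-identityˡ 0# ⟩
    0# ∎
    where
    rest : ∀ k (F : Fin (suc (suc k)) → Fin (suc k) → Carrier) →
      (∀ j j' → F (proj₁ (swapPick j j')) (proj₂ (swapPick j j')) + F j j' ≈ 0#) →
      sumFin (λ i → sumFin (λ i' → F (fsuc i) (fsuc i'))) ≈ 0#
    rest zero F h = ∑-zero (sumFin-linear 1) (λ i → sumFin (λ i' → F (fsuc i) (fsuc i'))) (λ i → refl)
    rest (suc k) F h = sumFin²-antisymmetric k (λ i i' → F (fsuc i) (fsuc i')) (λ i i' → h (fsuc i) (fsuc i'))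

  cancellingPair : ∀ a b s s' x y u v d → a * b ≈ - (s * s') → x * y ≈ u * v →
    (a * x) * ((b * y) * d) + (s * u) * ((s' * v) * d) ≈ 0#
  cancellingPair a b s s' x y u v d e1 e2 = begin
    (a * x) * ((b * y) * d) + (s * u) * ((s' * v) * d) ≈⟨ +-cong (rearr a x b y d) (rearr s u s' v d) ⟩
    (a * b) * ((x * y) * d) + (s * s') * ((u * v) * d)
       ≈⟨ +-congʳ (*-cong e1 (*-congʳ e2)) ⟩
    - (s * s') * ((u * v) * d) + (s * s') * ((u * v) * d)
       ≈⟨ +-congʳ (sym (-‿distribˡ-* _ _)) ⟩
    - ((s * s') * ((u * v) * d)) + (s * s') * ((u * v) * d) ≈⟨ -‿inverseˡ _ ⟩
    0# ∎
    where
    rearr : ∀ a x b y d → (a * x) * ((b * y) * d) ≈ (a * b) * ((x * y) * d)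
    rearr = solve 5 (λ a x b y d → (a ⊕ x) ⊕ ((b ⊕ y) ⊕ d) ⊜ (a ⊕ b) ⊕ ((x ⊕ y) ⊕ d)) refl

  module _ {k : ℕ} (M : Fin (suc (suc k)) → Fin (suc (suc k)) → Carrier) where
    minor₂ : Fin (suc (suc k)) → Fin (suc k) → Carrier
    minor₂ j j' = det k (λ a b → M (fsuc (fsuc a)) (punchIn j (punchIn j' b)))

    term₂ : Fin (suc (suc k)) → Fin (suc k) → Carrier
    term₂ j j' = (sgn (toℕ j) * M fzero j) * ((sgn (toℕ j') * M (fsuc fzero) (punchIn j j')) * minor₂ j j')

    det-expand₂ : det (suc (suc k)) M ≈ sumFin (λ j → sumFin (λ j' → term₂ j j'))
    det-expand₂ = ∑-cong (sumFin-linear (suc (suc k))) (λ j → *-∑ (sumFin-linear (suc k)) (sgn (toℕ j) * M fzero j) (λ j' → (sgn (toℕ j') * M (fsuc fzero) (punchIn j j')) * minor₂ j j'))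

    term₂-swapPick : ∀ j j' → term₂ (proj₁ (swapPick j j')) (proj₂ (swapPick j j')) ≈
       (sgn (toℕ (proj₁ (swapPick j j'))) * M fzero (punchIn j j'))
         * ((sgn (toℕ (proj₂ (swapPick j j'))) * M (fsuc fzero) j) * minor₂ j j')
    term₂-swapPick j j' = *-cong (*-congˡ (reflexive (P.cong (M fzero) (swapPick-fst j j'))))
      (*-cong (*-congˡ (reflexive (P.cong (M (fsuc fzero)) (swapPick-snd j j'))))
        (det-cong k (λ a b → reflexive (P.cong (M (fsuc (fsuc a))) (P.sym (swapPick-punchIn j j' b))))))

  det-equalRows01 : ∀ k (M : Fin (suc (suc k)) → Fin (suc (suc k)) → Carrier) →
    (∀ b → M fzero b ≈ M (fsuc fzero) b) → det (suc (suc k)) M ≈ 0#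
  det-equalRows01 k M e = trans (det-expand₂ M) (sumFin²-antisymmetric k (term₂ M) (λ j j' →
    trans (+-congʳ (term₂-swapPick M j j'))
      (cancellingPair _ _ _ _ _ _ _ _ _ (swapPick-sgn j j')
         (trans (*-cong (e _) (sym (e j))) (*-comm _ _)))))

  swap01 : ∀ {k} → Fin (suc (suc k)) → Fin (suc (suc k))
  swap01 fzero = fsuc fzero
  swap01 (fsuc fzero) = fzero
  swap01 (fsuc (fsuc a)) = fsuc (fsuc a)

  swap01-involutive : ∀ {k} (a : Fin (suc (suc k))) → swap01 (swap01 a) P.≡ a
  swap01-involutive fzero = P.refl
  swap01-involutive (fsuc fzero) = P.refl
  swap01-involutive (fsuc (fsuc a)) = P.refl

  det-swap01 : ∀ k (M : Fin (suc (suc k)) → Fin (suc (suc k)) → Carrier) →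
    det (suc (suc k)) (λ a b → M (swap01 a) b) ≈ - det (suc (suc k)) M
  det-swap01 k M = begin
    det (suc (suc k)) M' ≈⟨ sym (+-identityʳ _) ⟩
    det (suc (suc k)) M' + 0# ≈⟨ +-congˡ (sym (-‿inverseʳ (det (suc (suc k)) M))) ⟩
    det (suc (suc k)) M' + (det (suc (suc k)) M - det (suc (suc k)) M) ≈⟨ sym (+-assoc _ _ _) ⟩
    (det (suc (suc k)) M' + det (suc (suc k)) M) - det (suc (suc k)) M ≈⟨ +-congʳ sum0 ⟩
    0# - det (suc (suc k)) M ≈⟨ +-identityˡ _ ⟩
    - det (suc (suc k)) M ∎
    where
    M' = λ a b → M (swap01 a) b
    sum0 : det (suc (suc k)) M' + det (suc (suc k)) M ≈ 0#
    sum0 = begin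
      det (suc (suc k)) M' + det (suc (suc k)) M ≈⟨ +-cong (det-expand₂ M') (det-expand₂ M) ⟩
      sumFin (λ j → sumFin (λ j' → term₂ M' j j')) + sumFin (λ j → sumFin (λ j' → term₂ M j j'))
        ≈⟨ sym (trans (∑-cong (sumFin-linear (suc (suc k))) (λ j → ∑-+ (sumFin-linear (suc k)) (term₂ M' j) (term₂ M j))) (∑-+ (sumFin-linear (suc (suc k))) (λ j → sumFin (term₂ M' j)) (λ j → sumFin (term₂ M j)))) ⟩
      sumFin (λ j → sumFin (λ j' → term₂ M' j j' + term₂ M j j'))
        ≈⟨ sumFin²-antisymmetric k _ (λ j j' → trans (+-congˡ (+-comm _ _)) (trans (+P.interchange _ _ _ _) (trans (+-cong
              (trans (+-congʳ (term₂-swapPick M' j j')) (cancellingPair _ _ _ _ _ _ _ _ _ (swapPick-sgn j j') (*-comm _ _)))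
              (trans (+-congʳ (term₂-swapPick M j j')) (cancellingPair _ _ _ _ _ _ _ _ _ (swapPick-sgn j j') (*-comm _ _))))
              (+-identityˡ 0#)))) ⟩
      0# ∎

  raise : ∀ {k} → Fin (suc k) → Fin (suc k) → Fin (suc k)
  raise m fzero = m
  raise m (fsuc b) = punchIn m b

  private
    raise-zero : ∀ {k} (a : Fin (suc k)) → raise fzero a P.≡ a
    raise-zero fzero = P.refl
    raise-zero (fsuc a) = P.refl

  det-raise : ∀ k (M : Fin (suc k) → Fin (suc k) → Carrier) m →
    det (suc k) (λ a b → M (raise m a) b) ≈ sgn (toℕ m) * det (suc k) M
  det-raise k M fzero = trans (det-cong (suc k) (λ a b → reflexive (P.cong (λ x → M x b) (raise-zero a)))) (sym (*-identityˡ _))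
  det-raise (suc k) M (fsuc m) = begin
    det (suc (suc k)) M1 ≈⟨ det-cong (suc (suc k)) (λ a b → reflexive (P.cong (λ x → M1 x b) (P.sym (swap01-involutive a)))) ⟩
    det (suc (suc k)) (λ a b → M2 (swap01 a) b) ≈⟨ det-swap01 k M2 ⟩
    - det (suc (suc k)) M2 ≈⟨ -‿cong step ⟩
    - (sgn (toℕ m) * det (suc (suc k)) M) ≈⟨ -‿distribˡ-* _ _ ⟩
    sgn (toℕ (fsuc m)) * det (suc (suc k)) M ∎
    where
    M1 = λ a b → M (raise (fsuc m) a) b
    M2 = λ a b → M1 (swap01 a) b
    N : Fin (suc (suc k)) → Fin (suc k) → Fin (suc k) → Carrier
    N j a b = M (fsuc a) (punchIn j b)
    pw : ∀ j a b → M2 (fsuc a) (punchIn j b) ≈ N j (raise m a) b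
    pw j fzero b = refl
    pw j (fsuc a) b = refl
    step : det (suc (suc k)) M2 ≈ sgn (toℕ m) * det (suc (suc k)) M
    step = begin
      det (suc (suc k)) M2
        ≈⟨ ∑-cong (sumFin-linear (suc (suc k))) (λ j → *-congˡ {sgn (toℕ j) * M fzero j}
               (trans (det-cong (suc k) (pw j)) (det-raise k (N j) m))) ⟩
      sumFin (λ j → (sgn (toℕ j) * M fzero j) * (sgn (toℕ m) * det (suc k) (N j)))
        ≈⟨ ∑-cong (sumFin-linear (suc (suc k))) (λ j → *P.x∙yz≈y∙xz (sgn (toℕ j) * M fzero j) (sgn (toℕ m)) (det (suc k) (N j))) ⟩
      sumFin (λ j → sgn (toℕ m) * ((sgn (toℕ j) * M fzero j) * det (suc k) (N j)))
        ≈⟨ sym (*-∑ (sumFin-linear (suc (suc k))) (sgn (toℕ m)) (λ j → (sgn (toℕ j) * M fzero j) * det (suc k) (N j))) ⟩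
      sgn (toℕ m) * det (suc (suc k)) M ∎

  det-repeatedRow : ∀ k (M : Fin (suc k) → Fin (suc k) → Carrier) a →
    (∀ b → M fzero b ≈ M (fsuc a) b) → det (suc k) M ≈ 0#
  det-repeatedRow (suc k) M a e = sgn*-cancel (toℕ (fsuc a)) (trans (sym (det-raise (suc k) M (fsuc a)))
    (det-equalRows01 k (λ x b → M (raise (fsuc a) x) b) (λ b → sym (e b))))

  det-zeroRow : ∀ k (M : Fin (suc k) → Fin (suc k) → Carrier) →
    (∀ b → M fzero b ≈ 0#) → det (suc k) M ≈ 0#
  det-zeroRow k M e = ∑-zero (sumFin-linear (suc k)) (λ j → sgn (toℕ j) * M fzero j * det k (λ a b → M (fsuc a) (punchIn j b))) (λ j →
    trans (*-congʳ (trans (*-congˡ (e j)) (zeroʳ _))) (zeroˡ _))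

  det-zeroColumn : ∀ k (M : Fin (suc k) → Fin (suc k) → Carrier) →
    (∀ a → M a fzero ≈ 0#) → det (suc k) M ≈ 0#
  det-zeroColumn zero M e = trans (+-congʳ (trans (*-congʳ (trans (*-congˡ (e fzero)) (zeroʳ _))) (zeroˡ _))) (+-identityˡ 0#)
  det-zeroColumn (suc k) M e = trans (+-cong (trans (*-congʳ (trans (*-congˡ (e fzero)) (zeroʳ _))) (zeroˡ _))
     (∑-zero (sumFin-linear (suc k)) (λ j → sgn (toℕ (fsuc j)) * M fzero (fsuc j) * det (suc k) (λ a b → M (fsuc a) (punchIn (fsuc j) b)))
       (λ j → trans (*-congˡ (det-zeroColumn k (λ a b → M (fsuc a) (punchIn (fsuc j) b)) (λ a → e (fsuc a)))) (zeroʳ _))))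
     (+-identityˡ 0#)

  private
    leadingTerm : ∀ k (M : Fin (suc k) → Fin (suc k) → Carrier) → M fzero fzero ≈ 1# →
      sgn 0 * M fzero fzero * det k (λ a b → M (fsuc a) (punchIn fzero b)) ≈ det k (λ a b → M (fsuc a) (fsuc b))
    leadingTerm k M e = trans (*-congʳ (trans (*-identityˡ _) e)) (*-identityˡ _)

  det-unitRow : ∀ k (M : Fin (suc k) → Fin (suc k) → Carrier) → M fzero fzero ≈ 1# →
    (∀ b → M fzero (fsuc b) ≈ 0#) → det (suc k) M ≈ det k (λ a b → M (fsuc a) (fsuc b))
  det-unitRow k M e1 e0 = trans (+-cong (leadingTerm k M e1)
    (∑-zero (sumFin-linear k) (λ j → sgn (toℕ (fsuc j)) * M fzero (fsuc j) * det k (λ a b → M (fsuc a) (punchIn (fsuc j) b))) (λ j → trans (*-congʳ (trans (*-congˡ (e0 j)) (zeroʳ _))) (zeroˡ _))))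
    (+-identityʳ _)

  det-unitColumn : ∀ k (M : Fin (suc k) → Fin (suc k) → Carrier) → M fzero fzero ≈ 1# →
    (∀ a → M (fsuc a) fzero ≈ 0#) → det (suc k) M ≈ det k (λ a b → M (fsuc a) (fsuc b))
  det-unitColumn zero M e1 e0 = trans (+-congʳ (leadingTerm zero M e1)) (+-identityʳ _)
  det-unitColumn (suc k) M e1 e0 = trans (+-cong (leadingTerm (suc k) M e1)
    (∑-zero (sumFin-linear (suc k)) (λ j → sgn (toℕ (fsuc j)) * M fzero (fsuc j) * det (suc k) (λ a b → M (fsuc a) (punchIn (fsuc j) b)))
       (λ j → trans (*-congˡ (det-zeroColumn k (λ a b → M (fsuc a) (punchIn (fsuc j) b)) (λ a → e0 a))) (zeroʳ _))))
    (+-identityʳ _)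

  cauchy-binet : ∀ k N (X Y : ℕ → ℕ → Carrier) (R C : Fin k → ℕ) →
    det k (λ a b → sumRange N (λ l → X (R a) l * Y l (C b))) ≈
    sumInc k N (λ T → det k (λ a b → X (R a) (T b)) * det k (λ a b → Y (T a) (C b)))
  cauchy-binet zero N X Y R C = sym (*-identityˡ 1#)
  cauchy-binet (suc k) N X Y R C = begin
    det (suc k) (λ a b → sumRange N (λ l → X (R a) l * Y l (C b)))
      ≈⟨ ∑-cong (sumFin-linear (suc k)) (λ j → *-congˡ {sgn (toℕ j) * sumRange N (λ l → xs l * Y l (C j))}
            (cauchy-binet k N X Y (R ∘ fsuc) (C ∘ punchIn j))) ⟩
    sumFin (λ j → (sgn (toℕ j) * sumRange N (λ l → xs l * Y l (C j))) * S j)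
      ≈⟨ ∑-cong (sumFin-linear (suc k)) (λ j → expand-row0 j) ⟩
    sumFin (λ j → sumRange N (λ l → sumInc k N (λ T → E j l T)))
      ≈⟨ sumFin-exchange (suc k) (sumRange-linear N) (λ j l → sumInc k N (λ T → E j l T)) ⟩
    sumRange N (λ l → sumFin (λ j → sumInc k N (λ T → E j l T)))
      ≈⟨ ∑-cong (sumRange-linear N) (λ l → sumFin-exchange (suc k) (sumInc-linear k N) (λ j T → E j l T)) ⟩
    sumRange N (λ l → sumInc k N (λ T → sumFin (λ j → E j l T)))
      ≈⟨ ∑-cong (sumRange-linear N) (λ l → ∑-cong (sumInc-linear k N) (λ T → sum-E≈G l T)) ⟩
    sumRange N (λ l → sumInc k N (G l))
      ≈⟨ sumRange-sumInc-merge N k G G-resp G-vanishes ⟩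
    sumInc (suc k) N (λ U → sumFin (λ m → G (U m) (U ∘ punchIn m)))
      ≈⟨ ∑-cong (sumInc-linear (suc k) N) sum-G≈det*det ⟩
    sumInc (suc k) N (λ U → det (suc k) (λ a b → X (R a) (U b)) * det (suc k) (λ a b → Y (U a) (C b))) ∎
    where
    xs : ℕ → Carrier
    xs l = X (R fzero) l
    dX : (Fin k → ℕ) → Carrier
    dX T = det k (λ a b → X (R (fsuc a)) (T b))
    dY : (Fin k → ℕ) → Fin (suc k) → Carrier
    dY T j = det k (λ a b → Y (T a) (C (punchIn j b)))
    S : Fin (suc k) → Carrier
    S j = sumInc k N (λ T → dX T * dY T j)
    E : Fin (suc k) → ℕ → (Fin k → ℕ) → Carrier
    E j l T = (sgn (toℕ j) * (xs l * Y l (C j))) * (dX T * dY T j)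
    G : ℕ → (Fin k → ℕ) → Carrier
    G l T = (xs l * dX T) * det (suc k) (λ a b → Y ((l ∷ᵗ T) a) (C b))
    expand-row0 : ∀ j → (sgn (toℕ j) * sumRange N (λ l → xs l * Y l (C j))) * S j ≈
                   sumRange N (λ l → sumInc k N (λ T → E j l T))
    expand-row0 j = begin
      (sgn (toℕ j) * sumRange N (λ l → xs l * Y l (C j))) * S j
        ≈⟨ *-congʳ (*-∑ (sumRange-linear N) _ (λ l → xs l * Y l (C j))) ⟩
      sumRange N (λ l → sgn (toℕ j) * (xs l * Y l (C j))) * S j ≈⟨ *-comm _ _ ⟩
      S j * sumRange N (λ l → sgn (toℕ j) * (xs l * Y l (C j)))
        ≈⟨ *-∑ (sumRange-linear N) _ (λ l → sgn (toℕ j) * (xs l * Y l (C j))) ⟩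
      sumRange N (λ l → S j * (sgn (toℕ j) * (xs l * Y l (C j))))
        ≈⟨ ∑-cong (sumRange-linear N) (λ l → trans (*-comm _ _)
              (*-∑ (sumInc-linear k N) (sgn (toℕ j) * (xs l * Y l (C j))) (λ T → dX T * dY T j))) ⟩
      sumRange N (λ l → sumInc k N (λ T → E j l T)) ∎
    sum-E≈G : ∀ l T → sumFin (λ j → E j l T) ≈ G l T
    sum-E≈G l T = begin
      sumFin (λ j → E j l T) ≈⟨ ∑-cong (sumFin-linear (suc k)) (λ j → regroup (sgn (toℕ j)) (xs l) (Y l (C j)) (dX T) (dY T j)) ⟩
      sumFin (λ j → (xs l * dX T) * ((sgn (toℕ j) * Y l (C j)) * dY T j))
        ≈⟨ sym (*-∑ (sumFin-linear (suc k)) (xs l * dX T) (λ j → (sgn (toℕ j) * Y l (C j)) * dY T j)) ⟩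
      G l T ∎
      where
      regroup : ∀ s x y dx dy → (s * (x * y)) * (dx * dy) ≈ (x * dx) * ((s * y) * dy)
      regroup = solve 5 (λ s x y dx dy → (s ⊕ (x ⊕ y)) ⊕ (dx ⊕ dy) ⊜ (x ⊕ dx) ⊕ ((s ⊕ y) ⊕ dy)) refl
    cons-resp : ∀ l {T T' : Fin k → ℕ} → (∀ a → T a P.≡ T' a) → ∀ a → (l ∷ᵗ T) a P.≡ (l ∷ᵗ T') a
    cons-resp l e fzero = P.refl
    cons-resp l e (fsuc a) = e a
    G-resp : ∀ l → Respects≗ (G l)
    G-resp l e = *-cong (*-congˡ (det-cong k (λ a b → reflexive (P.cong (X (R (fsuc a))) (e b)))))
                       (det-cong (suc k) (λ a b → reflexive (P.cong (λ t → Y t (C b)) (cons-resp l e a))))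
    G-vanishes : ∀ l T a → T a P.≡ l → G l T ≈ 0#
    G-vanishes l T a e = trans (*-congˡ (det-repeatedRow k (λ a' b → Y ((l ∷ᵗ T) a') (C b)) a
                            (λ b → reflexive (P.cong (λ t → Y t (C b)) (P.sym e))))) (zeroʳ _)
    sum-G≈det*det : ∀ U → sumFin (λ m → G (U m) (U ∘ punchIn m)) ≈
                  det (suc k) (λ a b → X (R a) (U b)) * det (suc k) (λ a b → Y (U a) (C b))
    sum-G≈det*det U = begin
      sumFin (λ m → G (U m) (U ∘ punchIn m))
        ≈⟨ ∑-cong (sumFin-linear (suc k)) (λ m → *-congˡ {xs (U m) * dX (U ∘ punchIn m)}
              (trans (det-cong (suc k) (raise-cons m)) (det-raise k MY m))) ⟩
      sumFin (λ m → (xs (U m) * dX (U ∘ punchIn m)) * (sgn (toℕ m) * det (suc k) MY))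
        ≈⟨ ∑-cong (sumFin-linear (suc k)) (λ m → regroup (sgn (toℕ m)) (xs (U m)) (dX (U ∘ punchIn m)) (det (suc k) MY)) ⟩
      sumFin (λ m → ((sgn (toℕ m) * xs (U m)) * dX (U ∘ punchIn m)) * det (suc k) MY)
        ≈⟨ ∑-cong (sumFin-linear (suc k)) (λ m → *-comm ((sgn (toℕ m) * xs (U m)) * dX (U ∘ punchIn m)) (det (suc k) MY)) ⟩
      sumFin (λ m → det (suc k) MY * ((sgn (toℕ m) * xs (U m)) * dX (U ∘ punchIn m)))
        ≈⟨ sym (*-∑ (sumFin-linear (suc k)) (det (suc k) MY) (λ m → (sgn (toℕ m) * xs (U m)) * dX (U ∘ punchIn m))) ⟩
      det (suc k) MY * det (suc k) (λ a b → X (R a) (U b)) ≈⟨ *-comm _ _ ⟩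
      det (suc k) (λ a b → X (R a) (U b)) * det (suc k) MY ∎
      where
      MY = λ a b → Y (U a) (C b)
      regroup : ∀ s x dx dy → (x * dx) * (s * dy) ≈ ((s * x) * dx) * dy
      regroup = solve 4 (λ s x dx dy → (x ⊕ dx) ⊕ (s ⊕ dy) ⊜ ((s ⊕ x) ⊕ dx) ⊕ dy) refl
      raise-cons : ∀ m a b → Y ((U m ∷ᵗ U ∘ punchIn m) a) (C b) ≈ MY (raise m a) b
      raise-cons m fzero b = refl
      raise-cons m (fsuc a) b = refl

module Positivity {c ℓ p} (S : POCommRing c ℓ p) where

  open POCommRing S hiding (zero)
  open Determinants commRing
  open import Relation.Binary.Reasoning.Setoid setoid

  sumInc-nonneg : ∀ k N F → (∀ T → SI T → (∀ a → T a ℕ.< N) → Nonneg (F T)) → Nonneg (sumInc k N F)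
  sumInc-nonneg zero N F h = h nilᵗ (λ ()) (λ ())
  sumInc-nonneg (suc k) zero F h = Nonneg-0
  sumInc-nonneg (suc k) (suc N) F h =
    Nonneg-+ (sumInc-nonneg k N _ (λ T s b → h _ (SI-cons s) (bd₁ b)))
       (sumInc-nonneg (suc k) N _ (λ T s b → h _ (SI-suc s) (λ a → ℕ.s≤s (b a))))
    where
    bd₁ : ∀ {T : Fin k → ℕ} → (∀ a → T a ℕ.< N) → ∀ a → (0 ∷ᵗ suc ∘ T) a ℕ.< suc N
    bd₁ b fzero = ℕ.s≤s ℕ.z≤n
    bd₁ b (fsuc a) = ℕ.s≤s (b a)

  det-product-nonneg : ∀ k N (X Y : ℕ → ℕ → Carrier) (R C : Fin k → ℕ) →
    (∀ T → SI T → (∀ a → T a ℕ.< N) → Nonneg (det k (λ a b → X (R a) (T b)))) →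
    (∀ T → SI T → (∀ a → T a ℕ.< N) → Nonneg (det k (λ a b → Y (T a) (C b)))) →
    Nonneg (det k (λ a b → sumRange N (λ l → X (R a) l * Y l (C b))))
  det-product-nonneg k N X Y R C hx hy = Nonneg-resp (sym (cauchy-binet k N X Y R C))
    (sumInc-nonneg k N _ (λ T s b → Nonneg-* (hx T s b) (hy T s b)))

  module RowRecurrence (Q O : ℕ → ℕ → Carrier) (L : ℕ → ℕ)
    (O00 : O 0 0 ≈ 1#) (O0suc : ∀ k → O 0 (suc k) ≈ 0#)
    (Osuc : ∀ n k → O (suc n) k ≈ sumRange (L n) (λ j → O n j * Q j k))
    (O-vanishes : ∀ n j → L n ℕ.≤ j → O n j ≈ 0#)
    (r : Order) (Q-TP : TP rawRing Nonneg r Q) where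

    firstRow-vanishes : ∀ c → 1 ℕ.≤ c → O 0 c ≈ 0#
    firstRow-vanishes (suc c) _ = O0suc c

    minors-nonneg : ∀ m k → k ≤ᵒ r → (R C : Fin k → ℕ) → SI R → SI C → (∀ a → R a ℕ.< m) →
      Nonneg (det k (λ a b → O (R a) (C b)))
    minors-nonneg m zero _ R C _ _ _ = Nonneg-1
    minors-nonneg zero (suc k) _ R C _ _ bd = ⊥-elim (ℕP.n≮0 (bd fzero))
    minors-nonneg (suc m) (suc k) kr R C sR sC bd = byTopRow (R fzero) P.refl
      where
      M = λ a b → O (R a) (C b)
      byFirstColumn : R fzero P.≡ 0 → ∀ x → C fzero P.≡ x → Nonneg (det (suc k) M)
      byFirstColumn eqR zero eqC = Nonneg-resp (sym (det-unitRow k M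
                    (trans (reflexive (P.cong₂ O eqR eqC)) O00)
                    (λ b → trans (reflexive (P.cong (λ x → O x (C (fsuc b))) eqR))
                             (firstRow-vanishes _ (ℕP.≤-trans (ℕ.s≤s ℕ.z≤n) (P.subst (ℕ._< C (fsuc b)) eqC (SI-0< sC b)))))))
                   (minors-nonneg (suc m) k (≤ᵒ-pred kr) (R ∘ fsuc) (C ∘ fsuc) (SI-tail sR) (SI-tail sC) (bd ∘ fsuc))
      byFirstColumn eqR (suc c0) eqC = Nonneg-resp (sym (det-zeroRow k M
                    (λ b → trans (reflexive (P.cong (λ x → O x (C b)) eqR)) (firstRow-vanishes _ (SI-positive sC eqC b))))) Nonneg-0
      byTopRow : ∀ x → R fzero P.≡ x → Nonneg (det (suc k) M)
      byTopRow zero eqR = byFirstColumn eqR (C fzero) P.refl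
      byTopRow (suc r0) eqR =
        Nonneg-resp (sym (det-cong (suc k) entry))
          (det-product-nonneg (suc k) Nb O Q R' C
            (λ T sT _ → minors-nonneg m (suc k) kr R' T (SI-pred (SI-positive sR eqR) sR) sT
                          (λ a → ℕP.≤-pred (P.subst (ℕ._< suc m) (suc-pred (SI-positive sR eqR a)) (bd a))))
            (λ T sT _ → Q-TP (suc k) (ℕ.s≤s ℕ.z≤n) kr T C sT sC))
        where
        R' = λ a → ℕ.pred (R a)
        Nb = maxFin (λ a → L (R' a))
        entry : ∀ a b → O (R a) (C b) ≈ sumRange Nb (λ l → O (R' a) l * Q l (C b))
        entry a b = trans (reflexive (P.cong (λ x → O x (C b)) (suc-pred (SI-positive sR eqR a))))
                  (trans (Osuc (R' a) (C b))
                    (sumRange-pad≤ _ (maxFin-≤ (λ a → L (R' a)) a)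
                       (λ j Lj → trans (*-congʳ (O-vanishes (R' a) j Lj)) (zeroˡ _))))

    isTP : TP rawRing Nonneg r O
    isTP k _ kr rows cols sR sC =
      minors-nonneg (suc (maxFin rows)) k kr rows cols sR sC (λ a → ℕ.s≤s (maxFin-≤ rows a))

  -- RowRecurrence for the transposed matrix, redone because det is expanded
  -- along rows only.
  module ColumnRecurrence (Q V : ℕ → ℕ → Carrier) (L : ℕ → ℕ)
    (V00 : V 0 0 ≈ 1#) (V0suc : ∀ k → V 0 (suc k) ≈ 0#)
    (Vsuc : ∀ m k → V (suc m) k ≈ sumRange (L k) (λ j → Q k j * V m j))
    (Q-vanishes : ∀ k j → L k ℕ.≤ j → Q k j ≈ 0#)
    (r : Order) (Q-TP : TP rawRing Nonneg r Q) where

    firstRow-vanishes : ∀ c → 1 ℕ.≤ c → V 0 c ≈ 0#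
    firstRow-vanishes (suc c) _ = V0suc c

    minors-nonneg : ∀ m k → k ≤ᵒ r → (R S : Fin k → ℕ) → SI R → SI S → (∀ b → S b ℕ.< m) →
      Nonneg (det k (λ a b → V (S b) (R a)))
    minors-nonneg m zero _ R S _ _ _ = Nonneg-1
    minors-nonneg zero (suc k) _ R S _ _ bd = ⊥-elim (ℕP.n≮0 (bd fzero))
    minors-nonneg (suc m) (suc k) kr R S sR sS bd = byFirstColumn (S fzero) P.refl
      where
      M = λ a b → V (S b) (R a)
      byTopRow : S fzero P.≡ 0 → ∀ x → R fzero P.≡ x → Nonneg (det (suc k) M)
      byTopRow eqS zero eqR = Nonneg-resp (sym (det-unitColumn k M
                    (trans (reflexive (P.cong₂ V eqS eqR)) V00)
                    (λ a → trans (reflexive (P.cong (λ x → V x (R (fsuc a))) eqS))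
                             (firstRow-vanishes _ (ℕP.≤-trans (ℕ.s≤s ℕ.z≤n) (P.subst (ℕ._< R (fsuc a)) eqR (SI-0< sR a)))))))
                   (minors-nonneg (suc m) k (≤ᵒ-pred kr) (R ∘ fsuc) (S ∘ fsuc) (SI-tail sR) (SI-tail sS) (bd ∘ fsuc))
      byTopRow eqS (suc c0) eqR = Nonneg-resp (sym (det-zeroColumn k M
                    (λ a → trans (reflexive (P.cong (λ x → V x (R a)) eqS)) (firstRow-vanishes _ (SI-positive sR eqR a))))) Nonneg-0
      byFirstColumn : ∀ x → S fzero P.≡ x → Nonneg (det (suc k) M)
      byFirstColumn zero eqS = byTopRow eqS (R fzero) P.refl
      byFirstColumn (suc s0) eqS =
        Nonneg-resp (sym (det-cong (suc k) entry))
          (det-product-nonneg (suc k) Nb Q (λ j m' → V m' j) R S'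
            (λ T sT _ → Q-TP (suc k) (ℕ.s≤s ℕ.z≤n) kr R T sR sT)
            (λ T sT _ → minors-nonneg m (suc k) kr T S' sT (SI-pred (SI-positive sS eqS) sS)
                          (λ b → ℕP.≤-pred (P.subst (ℕ._< suc m) (suc-pred (SI-positive sS eqS b)) (bd b)))))
        where
        S' = λ b → ℕ.pred (S b)
        Nb = maxFin (λ a → L (R a))
        entry : ∀ a b → V (S b) (R a) ≈ sumRange Nb (λ l → Q (R a) l * V (S' b) l)
        entry a b = trans (reflexive (P.cong (λ x → V x (R a)) (suc-pred (SI-positive sS eqS b))))
                  (trans (Vsuc (S' b) (R a))
                    (sumRange-pad≤ _ (maxFin-≤ (λ a → L (R a)) a)
                       (λ j Lj → trans (*-congʳ (Q-vanishes (R a) j Lj)) (zeroˡ _))))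

    isTP : TP rawRing Nonneg r (λ k m → V m k)
    isTP k _ kr rows cols sR sC =
      minors-nonneg (suc (maxFin cols)) k kr rows cols sR sC (λ a → ℕ.s≤s (maxFin-≤ cols a))

maxRange-≤ : ∀ {c ℓ p} (R : POCommRing c ℓ p) n (f : ℕ → ℕ) l → l ℕ.< n → f l ℕ.≤ maxRange R n f
maxRange-≤ R (suc n) f l l<n with ℕP.m≤n⇒m<n∨m≡n (ℕP.≤-pred l<n)
... | inj₁ l<n' = ℕP.≤-trans (maxRange-≤ R n f l l<n') (ℕP.m≤m⊔n _ _)
... | inj₂ P.refl = ℕP.m≤n⊔m _ _

module OutputMatrix {c ℓ p : Level} (R : POCommRing c ℓ p)
    (P : ℕ → ℕ → POCommRing.Carrier R) (rf : RowFinite R P) where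
  open POCommRing R
  open Determinants commRing
  open RowFinite rf

  idM-above : ∀ i j → i ℕ.< j → idM R i j ≈ 0#
  idM-above ℕ.zero (ℕ.suc j) _ = refl
  idM-above (ℕ.suc i) (ℕ.suc j) (ℕ.s≤s lt) = idM-above i j lt

  powM-vanishes : ∀ n i j → powBound R P rf n i ℕ.≤ j → powM R P rf n i j ≈ 0#
  powM-vanishes ℕ.zero i j le = idM-above i j le
  powM-vanishes (ℕ.suc n) i j le =
    sumRange-zero< (powBound R P rf n i) _ (λ l l< →
      trans (*-congˡ (vanish l j (ℕP.≤-trans (maxRange-≤ R (powBound R P rf n i) bound l l<) le))) (zeroʳ _))

  module Pos = Positivity R

  outputMatrix-TP : (r : Order) → TP rawRing Nonneg r P → TP rawRing Nonneg r (outputMatrix R P rf)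
  outputMatrix-TP r tp = Pos.RowRecurrence.isTP P (outputMatrix R P rf) (λ n → powBound R P rf n 0)
    refl (λ k → refl) (λ n k → refl) (λ n j → powM-vanishes n 0 j) r tp

module Polynomials {c ℓ p : Level} (R : POCommRing c ℓ p) where

  open import Data.List.Relation.Unary.All using ([]; _∷_)

  open POCommRing R hiding (zero)
  open Determinants commRing
  open import Algebra.Properties.Ring ring using (-0#≈0#)
  open import Relation.Binary.Reasoning.Setoid setoid

  _≈P_ : Poly R → Poly R → Set ℓ
  p ≈P q = ∀ n → coeff R p n ≈ coeff R q n

  coeff-add : ∀ p q n → coeff R (addP R p q) n ≈ coeff R p n + coeff R q n
  coeff-add [] q n = sym (+-identityˡ _)
  coeff-add (a ∷ p) [] n = sym (+-identityʳ _)
  coeff-add (a ∷ p) (b ∷ q) zero = refl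
  coeff-add (a ∷ p) (b ∷ q) (suc n) = coeff-add p q n

  coeff-neg : ∀ p n → coeff R (map (-_) p) n ≈ - coeff R p n
  coeff-neg [] n = sym -0#≈0#
  coeff-neg (a ∷ p) zero = refl
  coeff-neg (a ∷ p) (suc n) = coeff-neg p n

  coeff-scale : ∀ a q n → coeff R (map (a *_) q) n ≈ a * coeff R q n
  coeff-scale a [] n = sym (zeroʳ a)
  coeff-scale a (b ∷ q) zero = refl
  coeff-scale a (b ∷ q) (suc n) = coeff-scale a q n

  conv : (ℕ → Carrier) → (ℕ → Carrier) → ℕ → Carrier
  conv f g n = sumRange (suc n) (λ i → f i * g (n ∸ i))

  coeff-mul : ∀ p q n → coeff R (mulP R p q) n ≈ conv (coeff R p) (coeff R q) n
  coeff-mul [] q n = sym (∑-zero (sumRange-linear (suc n)) _ (λ i → zeroˡ _))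
  coeff-mul (a ∷ p) q zero = begin
    coeff R (addP R (map (a *_) q) (0# ∷ mulP R p q)) zero ≈⟨ coeff-add (map (a *_) q) _ zero ⟩
    coeff R (map (a *_) q) zero + 0# ≈⟨ +-identityʳ _ ⟩
    coeff R (map (a *_) q) zero ≈⟨ coeff-scale a q zero ⟩
    a * coeff R q zero ≈⟨ sym (+-identityˡ _) ⟩
    conv (coeff R (a ∷ p)) (coeff R q) zero ∎
  coeff-mul (a ∷ p) q (suc n) = begin
    coeff R (addP R (map (a *_) q) (0# ∷ mulP R p q)) (suc n) ≈⟨ coeff-add (map (a *_) q) _ (suc n) ⟩
    coeff R (map (a *_) q) (suc n) + coeff R (mulP R p q) n ≈⟨ +-cong (coeff-scale a q (suc n)) (coeff-mul p q n) ⟩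
    a * coeff R q (suc n) + conv (coeff R p) (coeff R q) n ≈⟨ sym (sumRange-sucˡ (suc n) _) ⟩
    conv (coeff R (a ∷ p)) (coeff R q) (suc n) ∎

  conv-cong : ∀ {f f' g g'} → (∀ n → f n ≈ f' n) → (∀ n → g n ≈ g' n) → ∀ n → conv f g n ≈ conv f' g' n
  conv-cong ef eg n = ∑-cong (sumRange-linear (suc n)) (λ i → *-cong (ef i) (eg (n ∸ i)))

  sumRange-reverse : ∀ n f → sumRange n f ≈ sumRange n (λ i → f (n ∸ suc i))
  sumRange-reverse zero f = refl
  sumRange-reverse (suc n) f = begin
    sumRange n f + f n ≈⟨ +-comm _ _ ⟩
    f n + sumRange n f ≈⟨ +-congˡ (sumRange-reverse n f) ⟩
    f n + sumRange n (λ i → f (n ∸ suc i)) ≈⟨ sym (sumRange-sucˡ n (λ i → f (suc n ∸ suc i))) ⟩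
    sumRange (suc n) (λ i → f (suc n ∸ suc i)) ∎

  conv-comm : ∀ f g n → conv f g n ≈ conv g f n
  conv-comm f g n = begin
    sumRange (suc n) (λ i → f i * g (n ∸ i)) ≈⟨ sumRange-reverse (suc n) _ ⟩
    sumRange (suc n) (λ i → f (n ∸ i) * g (n ∸ (n ∸ i)))
      ≈⟨ sumRange-cong< (suc n) (λ i i<n → trans (*-comm _ _)
            (*-congʳ (reflexive (P.cong g (ℕP.m∸[m∸n]≡n (ℕP.≤-pred i<n)))))) ⟩
    sumRange (suc n) (λ i → g i * f (n ∸ i)) ∎

  private
    sn∸j : ∀ {n j} → j ℕ.≤ n → suc n ∸ j P.≡ suc (n ∸ j)
    sn∸j {n} {j} le = ℕP.+-∸-assoc 1 le

  sumRange-triangle : ∀ n (F : ℕ → ℕ → Carrier) →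
    sumRange n (λ i → sumRange (suc i) (λ j → F j (i ∸ j))) ≈ sumRange n (λ j → sumRange (n ∸ j) (F j))
  sumRange-triangle zero F = refl
  sumRange-triangle (suc n) F = begin
    sumRange n (λ i → sumRange (suc i) (λ j → F j (i ∸ j))) + sumRange (suc n) (λ j → F j (n ∸ j))
      ≈⟨ +-congʳ (sumRange-triangle n F) ⟩
    sumRange n (λ j → sumRange (n ∸ j) (F j)) + (sumRange n (λ j → F j (n ∸ j)) + F n (n ∸ n))
      ≈⟨ sym (+-assoc _ _ _) ⟩
    (sumRange n (λ j → sumRange (n ∸ j) (F j)) + sumRange n (λ j → F j (n ∸ j))) + F n (n ∸ n)
      ≈⟨ +-cong (trans (sym (∑-+ (sumRange-linear n) (λ j → sumRange (n ∸ j) (F j)) (λ j → F j (n ∸ j))))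
                       (sumRange-cong< n (λ j j<n → sym (reflexive (P.cong (λ t → sumRange t (F j)) (sn∸j (ℕP.<⇒≤ j<n)))))))
                (trans (reflexive (P.cong (F n) (ℕP.n∸n≡0 n))) (trans (sym (+-identityˡ _))
                   (reflexive (P.cong (λ t → sumRange t (F n)) (P.sym (P.trans (sn∸j {n} ℕP.≤-refl) (P.cong suc (ℕP.n∸n≡0 n)))))))) ⟩
    sumRange (suc n) (λ j → sumRange (suc n ∸ j) (F j)) ∎

  conv-assoc : ∀ f g h n → conv (conv f g) h n ≈ conv f (conv g h) n
  conv-assoc f g h n = begin
    sumRange (suc n) (λ i → conv f g i * h (n ∸ i))
      ≈⟨ ∑-cong (sumRange-linear (suc n)) (λ i → sumRange-*ʳ (suc i) _ (h (n ∸ i))) ⟩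
    sumRange (suc n) (λ i → sumRange (suc i) (λ j → (f j * g (i ∸ j)) * h (n ∸ i)))
      ≈⟨ sumRange-cong< (suc n) (λ i i<n → sumRange-cong< (suc i) (λ j j<i →
            trans (*-assoc _ _ _) (*-congˡ (*-congˡ (reflexive (P.cong h (P.sym (eqn (ℕP.≤-pred j<i))))))))) ⟩
    sumRange (suc n) (λ i → sumRange (suc i) (λ j → F j (i ∸ j))) ≈⟨ sumRange-triangle (suc n) F ⟩
    sumRange (suc n) (λ j → sumRange (suc n ∸ j) (F j))
      ≈⟨ sumRange-cong< (suc n) (λ j j<n → trans (reflexive (P.cong (λ t → sumRange t (F j)) (sn∸j (ℕP.≤-pred j<n))))
            (sym (*-∑ (sumRange-linear (suc (n ∸ j))) (f j) _))) ⟩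
    conv f (conv g h) n ∎
    where
    F : ℕ → ℕ → Carrier
    F j l = f j * (g l * h (n ∸ j ∸ l))
    eqn : ∀ {i j} → j ℕ.≤ i → n ∸ j ∸ (i ∸ j) P.≡ n ∸ i
    eqn {i} {j} le = P.trans (ℕP.∸-+-assoc n j (i ∸ j)) (P.cong (n ∸_) (ℕP.m+[n∸m]≡n le))

  private
    _+P_ = addP R
    _*P_ = mulP R
    -P_ = map (-_)
    0P : Poly R
    0P = []
    1P : Poly R
    1P = 1# ∷ []

  conv-identityˡ : ∀ f n → conv (coeff R 1P) f n ≈ f n
  conv-identityˡ f n = begin
    conv (coeff R 1P) f n ≈⟨ sumRange-sucˡ n _ ⟩
    1# * f n + sumRange n (λ i → 0# * f (n ∸ suc i)) ≈⟨ +-cong (*-identityˡ _) (∑-zero (sumRange-linear n) _ (λ i → zeroˡ _)) ⟩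
    f n + 0# ≈⟨ +-identityʳ _ ⟩
    f n ∎

  polyRing : CommutativeRing c ℓ
  polyRing = record
    { Carrier = Poly R
    ; _≈_ = _≈P_
    ; _+_ = _+P_
    ; _*_ = _*P_
    ; -_ = -P_
    ; 0# = 0P
    ; 1# = 1P
    ; isCommutativeRing = record
      { isRing = record
        { +-isAbelianGroup = record
          { isGroup = record
            { isMonoid = record
              { isSemigroup = record
                { isMagma = record
                  { isEquivalence = record { refl = λ n → refl ; sym = λ e n → sym (e n) ; trans = λ e f n → trans (e n) (f n) }
                  ; ∙-cong = λ {x} {y} {u} {v} e f n → trans (coeff-add x u n) (trans (+-cong (e n) (f n)) (sym (coeff-add y v n)))
                  }
                ; assoc = λ x y z n → trans (coeff-add (x +P y) z n) (trans (+-congʳ (coeff-add x y n))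
                            (trans (+-assoc _ _ _) (sym (trans (coeff-add x (y +P z) n) (+-congˡ (coeff-add y z n))))))
                }
              ; identity = (λ x n → refl) , (λ x n → trans (coeff-add x [] n) (+-identityʳ _))
              }
            ; inverse = (λ x n → trans (coeff-add (-P x) x n) (trans (+-congʳ (coeff-neg x n)) (-‿inverseˡ _)))
                      , (λ x n → trans (coeff-add x (-P x) n) (trans (+-congˡ (coeff-neg x n)) (-‿inverseʳ _)))
            ; ⁻¹-cong = λ {x} {y} e n → trans (coeff-neg x n) (trans (-‿cong (e n)) (sym (coeff-neg y n)))
            }
          ; comm = λ x y n → trans (coeff-add x y n) (trans (+-comm _ _) (sym (coeff-add y x n)))
          }
        ; *-cong = λ {x} {y} {u} {v} e f n → trans (coeff-mul x u n)
                    (trans (conv-cong {coeff R x} {coeff R y} {coeff R u} {coeff R v} e f n) (sym (coeff-mul y v n)))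
        ; *-assoc = λ x y z n → trans (coeff-mul (x *P y) z n)
                      (trans (conv-cong {coeff R (x *P y)} {conv (coeff R x) (coeff R y)} {coeff R z} {coeff R z} (coeff-mul x y) (λ _ → refl) n)
                      (trans (conv-assoc (coeff R x) (coeff R y) (coeff R z) n)
                      (sym (trans (coeff-mul x (y *P z) n)
                        (conv-cong {coeff R x} {coeff R x} {coeff R (y *P z)} {conv (coeff R y) (coeff R z)} (λ _ → refl) (coeff-mul y z) n)))))
        ; *-identity = (λ x n → trans (coeff-mul 1P x n) (conv-identityˡ (coeff R x) n))
                     , (λ x n → trans (coeff-mul x 1P n) (trans (conv-comm (coeff R x) (coeff R 1P) n) (conv-identityˡ (coeff R x) n)))
        ; distrib = dl , dr
        }
      ; *-comm = λ x y n → trans (coeff-mul x y n) (trans (conv-comm (coeff R x) (coeff R y) n) (sym (coeff-mul y x n)))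
      }
    }

    where
    dl : ∀ x y z → (x *P (y +P z)) ≈P ((x *P y) +P (x *P z))
    dl x y z n = trans (coeff-mul x (y +P z) n)
      (trans (conv-cong {coeff R x} {coeff R x} {coeff R (y +P z)} {λ m → coeff R y m + coeff R z m} (λ _ → refl) (coeff-add y z) n)
      (trans (trans (∑-cong (sumRange-linear (suc n)) (λ i → distribˡ _ _ _))
                    (∑-+ (sumRange-linear (suc n)) (λ i → coeff R x i * coeff R y (n ∸ i)) (λ i → coeff R x i * coeff R z (n ∸ i))))
        (sym (trans (coeff-add (x *P y) (x *P z) n) (+-cong (coeff-mul x y n) (coeff-mul x z n))))))
    dr : ∀ x y z → ((y +P z) *P x) ≈P ((y *P x) +P (z *P x))
    dr x y z n = trans (coeff-mul (y +P z) x n)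
      (trans (conv-cong {coeff R (y +P z)} {λ m → coeff R y m + coeff R z m} {coeff R x} {coeff R x} (coeff-add y z) (λ _ → refl) n)
      (trans (trans (∑-cong (sumRange-linear (suc n)) (λ i → distribʳ _ _ _))
                    (∑-+ (sumRange-linear (suc n)) (λ i → coeff R y i * coeff R x (n ∸ i)) (λ i → coeff R z i * coeff R x (n ∸ i))))
        (sym (trans (coeff-add (y *P x) (z *P x) n) (+-cong (coeff-mul y x n) (coeff-mul z x n))))))

  NonnegPoly⇒coeff : ∀ {q} → NonnegPoly R q → ∀ n → Nonneg (coeff R q n)
  NonnegPoly⇒coeff [] n = Nonneg-0
  NonnegPoly⇒coeff (h ∷ hs) zero = h
  NonnegPoly⇒coeff (h ∷ hs) (suc n) = NonnegPoly⇒coeff hs n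

  coeff⇒NonnegPoly : ∀ q → (∀ n → Nonneg (coeff R q n)) → NonnegPoly R q
  coeff⇒NonnegPoly [] h = []
  coeff⇒NonnegPoly (a ∷ q) h = h zero ∷ coeff⇒NonnegPoly q (λ n → h (suc n))

  NonnegPoly-resp : ∀ {x y} → x ≈P y → NonnegPoly R x → NonnegPoly R y
  NonnegPoly-resp {x} {y} e nx = coeff⇒NonnegPoly y (λ n → Nonneg-resp (e n) (NonnegPoly⇒coeff nx n))

  NonnegPoly-1 : NonnegPoly R (1# ∷ [])
  NonnegPoly-1 = Nonneg-1 ∷ []

  NonnegPoly-+ : ∀ {x y} → NonnegPoly R x → NonnegPoly R y → NonnegPoly R (addP R x y)
  NonnegPoly-+ [] hy = hy
  NonnegPoly-+ (h ∷ hx) [] = h ∷ hx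
  NonnegPoly-+ (h ∷ hx) (g ∷ hy) = Nonneg-+ h g ∷ NonnegPoly-+ hx hy

  NonnegPoly-scale : ∀ {a q} → Nonneg a → NonnegPoly R q → NonnegPoly R (map (a *_) q)
  NonnegPoly-scale ha [] = []
  NonnegPoly-scale ha (h ∷ hq) = Nonneg-* ha h ∷ NonnegPoly-scale ha hq

  NonnegPoly-* : ∀ {x y} → NonnegPoly R x → NonnegPoly R y → NonnegPoly R (mulP R x y)
  NonnegPoly-* [] hy = []
  NonnegPoly-* (h ∷ hx) hy = NonnegPoly-+ (NonnegPoly-scale h hy) (Nonneg-0 ∷ NonnegPoly-* hx hy)

  -- R[x] again, with its equality wrapped in a record and its operations opaque,
  -- so that Agda can infer ring elements from equations; detᵂ≡det converts back.
  record _≈W_ (p q : Poly R) : Set ℓ where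
    constructor wrap
    field unwrap : p ≈P q
  open _≈W_ public

  module PolyRing = CommutativeRing polyRing

  opaque
    addW : Poly R → Poly R → Poly R
    addW = addP R
    mulW : Poly R → Poly R → Poly R
    mulW = mulP R
    negW : Poly R → Poly R
    negW = map (-_)

  opaque
    unfolding addW mulW negW
    addW-eq : ∀ x y → addW x y P.≡ addP R x y
    addW-eq x y = P.refl
    mulW-eq : ∀ x y → mulW x y P.≡ mulP R x y
    mulW-eq x y = P.refl
    negW-eq : ∀ x → negW x P.≡ map (-_) x
    negW-eq x = P.refl

    w-refl : ∀ {x} → x ≈W x
    w-refl {x} = wrap (PolyRing.refl {x})
    w-sym : ∀ {x y} → x ≈W y → y ≈W x
    w-sym {x} {y} e = wrap (PolyRing.sym {x} {y} (unwrap e))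
    w-trans : ∀ {x y z} → x ≈W y → y ≈W z → x ≈W z
    w-trans {x} {y} {z} e f = wrap (PolyRing.trans {x} {y} {z} (unwrap e) (unwrap f))
    w+cong : ∀ {x y u v} → x ≈W y → u ≈W v → addW x u ≈W addW y v
    w+cong {x} {y} {u} {v} e f = wrap (PolyRing.+-cong {x} {y} {u} {v} (unwrap e) (unwrap f))
    w+assoc : ∀ x y z → addW (addW x y) z ≈W addW x (addW y z)
    w+assoc x y z = wrap (PolyRing.+-assoc x y z)
    w+idˡ : ∀ x → addW [] x ≈W x
    w+idˡ x = wrap (PolyRing.+-identityˡ x)
    w+idʳ : ∀ x → addW x [] ≈W x
    w+idʳ x = wrap (PolyRing.+-identityʳ x)
    w-invˡ : ∀ x → addW (negW x) x ≈W []
    w-invˡ x = wrap (PolyRing.-‿inverseˡ x)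
    w-invʳ : ∀ x → addW x (negW x) ≈W []
    w-invʳ x = wrap (PolyRing.-‿inverseʳ x)
    w-negcong : ∀ {x y} → x ≈W y → negW x ≈W negW y
    w-negcong {x} {y} e = wrap (PolyRing.-‿cong {x} {y} (unwrap e))
    w+comm : ∀ x y → addW x y ≈W addW y x
    w+comm x y = wrap (PolyRing.+-comm x y)
    w*cong : ∀ {x y u v} → x ≈W y → u ≈W v → mulW x u ≈W mulW y v
    w*cong {x} {y} {u} {v} e f = wrap (PolyRing.*-cong {x} {y} {u} {v} (unwrap e) (unwrap f))
    w*assoc : ∀ x y z → mulW (mulW x y) z ≈W mulW x (mulW y z)
    w*assoc x y z = wrap (PolyRing.*-assoc x y z)
    w*idˡ : ∀ x → mulW (1# ∷ []) x ≈W x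
    w*idˡ x = wrap (PolyRing.*-identityˡ x)
    w*idʳ : ∀ x → mulW x (1# ∷ []) ≈W x
    w*idʳ x = wrap (PolyRing.*-identityʳ x)
    w-distˡ : ∀ x y z → mulW x (addW y z) ≈W addW (mulW x y) (mulW x z)
    w-distˡ x y z = wrap (PolyRing.distribˡ x y z)
    w-distʳ : ∀ x y z → mulW (addW y z) x ≈W addW (mulW y x) (mulW z x)
    w-distʳ x y z = wrap (PolyRing.distribʳ x y z)
    w*comm : ∀ x y → mulW x y ≈W mulW y x
    w*comm x y = wrap (PolyRing.*-comm x y)

  polyRingᵂ : CommutativeRing c ℓ
  polyRingᵂ = record
    { Carrier = Poly R
    ; _≈_ = _≈W_
    ; _+_ = addW
    ; _*_ = mulW
    ; -_ = negW
    ; 0# = []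
    ; 1# = 1# ∷ []
    ; isCommutativeRing = record
      { isRing = record
        { +-isAbelianGroup = record
          { isGroup = record
            { isMonoid = record
              { isSemigroup = record
                { isMagma = record
                  { isEquivalence = record { refl = w-refl ; sym = w-sym ; trans = w-trans }
                  ; ∙-cong = w+cong
                  }
                ; assoc = w+assoc
                }
              ; identity = w+idˡ , w+idʳ
              }
            ; inverse = w-invˡ , w-invʳ
            ; ⁻¹-cong = w-negcong
            }
          ; comm = w+comm
          }
        ; *-cong = w*cong
        ; *-assoc = w*assoc
        ; *-identity = w*idˡ , w*idʳ
        ; distrib = w-distˡ , w-distʳ
        }
      ; *-comm = w*comm
      }
    }

  NonnegPoly-anti : ∀ {x} → NonnegPoly R x → NonnegPoly R (negW x) → x ≈W []
  NonnegPoly-anti {x} hx h-x = wrap λ n → Nonneg-anti (NonnegPoly⇒coeff hx n)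
    (Nonneg-resp (coeff-neg x n) (NonnegPoly⇒coeff (P.subst (NonnegPoly R) (negW-eq x) h-x) n))

  polyPOCommRing : POCommRing c ℓ (c ⊔ p)
  polyPOCommRing = record
    { commRing    = polyRingᵂ
    ; Nonneg      = NonnegPoly R
    ; Nonneg-resp = λ e → NonnegPoly-resp (unwrap e)
    ; Nonneg-0    = []
    ; Nonneg-1    = NonnegPoly-1
    ; Nonneg-+    = λ {x} {y} hx hy → P.subst (NonnegPoly R) (P.sym (addW-eq x y)) (NonnegPoly-+ hx hy)
    ; Nonneg-*    = λ {x} {y} hx hy → P.subst (NonnegPoly R) (P.sym (mulW-eq x y)) (NonnegPoly-* hx hy)
    ; Nonneg-anti = NonnegPoly-anti
    }

  module W = RawOps (CommutativeRing.rawRing polyRingᵂ)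
  module U = RawOps (polyRawRing R)

  sumFinᵂ≡sumFin : ∀ n (f g : Fin n → Poly R) → (∀ i → f i P.≡ g i) → W.sumFin f P.≡ U.sumFin g
  sumFinᵂ≡sumFin zero f g e = P.refl
  sumFinᵂ≡sumFin (suc n) f g e = P.trans (addW-eq _ _) (P.cong₂ (addP R) (e fzero) (sumFinᵂ≡sumFin n (λ i → f (fsuc i)) (λ i → g (fsuc i)) (λ i → e (fsuc i))))

  sumRangeᵂ≡sumRange : ∀ n (f g : ℕ → Poly R) → (∀ i → f i P.≡ g i) → W.sumRange n f P.≡ U.sumRange n g
  sumRangeᵂ≡sumRange zero f g e = P.refl
  sumRangeᵂ≡sumRange (suc n) f g e = P.trans (addW-eq _ _) (P.cong₂ (addP R) (sumRangeᵂ≡sumRange n f g e) (e n))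

  sgnᵂ≡sgn : ∀ n → W.sgn n P.≡ U.sgn n
  sgnᵂ≡sgn zero = P.refl
  sgnᵂ≡sgn (suc n) = P.trans (negW-eq _) (P.cong (map (-_)) (sgnᵂ≡sgn n))

  detᵂ≡det : ∀ k M → W.det k M P.≡ U.det k M
  detᵂ≡det zero M = P.refl
  detᵂ≡det (suc k) M = sumFinᵂ≡sumFin (suc k) _ _ (λ j →
    P.trans (P.trans (mulW-eq (mulW (W.sgn (toℕ j)) (M fzero j)) (W.det k (λ a b → M (fsuc a) (punchIn j b))))
       (P.cong (λ t → mulP R t (W.det k (λ a b → M (fsuc a) (punchIn j b)))) (mulW-eq (W.sgn (toℕ j)) (M fzero j))))
    (P.cong₂ (λ s d → mulP R (mulP R s (M fzero j)) d) (sgnᵂ≡sgn (toℕ j)) (detᵂ≡det k (λ a b → M (fsuc a) (punchIn j b)))))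

module Binomial {c ℓ p : Level} (R : POCommRing c ℓ p) where

  open import Data.Nat using (_≟_; _≤?_)
  open import Data.Nat.Combinatorics using (_C_; nCn≡1; nCk+nC[k+1]≡[n+1]C[k+1])

  open POCommRing R hiding (zero)
  open Determinants commRing
  open Polynomials R
  open import Algebra.Properties.Ring ring using (-0#≈0#; -‿distribˡ-*)
  open import Relation.Binary.Reasoning.Setoid setoid

  fromℕ-+ : ∀ m n → fromℕ (m ℕ.+ n) ≈ fromℕ m + fromℕ n
  fromℕ-+ zero n = sym (+-identityˡ _)
  fromℕ-+ (suc m) n = trans (+-congˡ (fromℕ-+ m n)) (sym (+-assoc _ _ _))

  coeff-monomial : ∀ d a → coeff R (monomial R d a) d P.≡ a
  coeff-monomial zero a = P.refl
  coeff-monomial (suc d) a = coeff-monomial d a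

  coeff-monomial-≢ : ∀ d a n → ¬ n P.≡ d → coeff R (monomial R d a) n P.≡ 0#
  coeff-monomial-≢ zero a zero ne = ⊥-elim (ne P.refl)
  coeff-monomial-≢ zero a (suc n) ne = P.refl
  coeff-monomial-≢ (suc d) a zero ne = P.refl
  coeff-monomial-≢ (suc d) a (suc n) ne = coeff-monomial-≢ d a n (ne ∘ P.cong suc)

  Bx-above : ∀ i j → ¬ j ℕ.≤ i → Bx R i j P.≡ []
  Bx-above i j nle with j ≤? i
  ... | yes le = ⊥-elim (nle le)
  ... | no _ = P.refl

  BxInv-above : ∀ i j → ¬ j ℕ.≤ i → BxInv R i j P.≡ []
  BxInv-above i j nle with j ≤? i
  ... | yes le = ⊥-elim (nle le)
  ... | no _ = P.refl

  BxCoeff : ℕ → ℕ → ℕ → Carrier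
  BxCoeff i j n with j ℕ.+ n ≟ i
  ... | yes _ = fromℕ (i C j)
  ... | no _ = 0#

  BxCoeff-≡ : ∀ i j n → j ℕ.+ n P.≡ i → BxCoeff i j n P.≡ fromℕ (i C j)
  BxCoeff-≡ i j n e with j ℕ.+ n ≟ i
  ... | yes _ = P.refl
  ... | no ne = ⊥-elim (ne e)

  BxCoeff-≢ : ∀ i j n → ¬ j ℕ.+ n P.≡ i → BxCoeff i j n P.≡ 0#
  BxCoeff-≢ i j n ne with j ℕ.+ n ≟ i
  ... | yes e = ⊥-elim (ne e)
  ... | no _ = P.refl

  BxInvCoeff : ℕ → ℕ → ℕ → Carrier
  BxInvCoeff i j n with j ℕ.+ n ≟ i
  ... | yes _ = sgn n * fromℕ (i C j)
  ... | no _ = 0#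

  BxInvCoeff-≡ : ∀ i j n → j ℕ.+ n P.≡ i → BxInvCoeff i j n P.≡ sgn n * fromℕ (i C j)
  BxInvCoeff-≡ i j n e with j ℕ.+ n ≟ i
  ... | yes _ = P.refl
  ... | no ne = ⊥-elim (ne e)

  BxInvCoeff-≢ : ∀ i j n → ¬ j ℕ.+ n P.≡ i → BxInvCoeff i j n P.≡ 0#
  BxInvCoeff-≢ i j n ne with j ℕ.+ n ≟ i
  ... | yes e = ⊥-elim (ne e)
  ... | no _ = P.refl

  private
    n≡i∸j : ∀ {i j n} → j ℕ.+ n P.≡ i → n P.≡ i ∸ j
    n≡i∸j {i} {j} {n} e = P.trans (P.sym (ℕP.m+n∸m≡n j n)) (P.cong (_∸ j) e)

  coeff-Bx : ∀ i j n → coeff R (Bx R i j) n ≈ BxCoeff i j n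
  coeff-Bx i j n with j ≤? i
  ... | no nle = reflexive (P.sym (BxCoeff-≢ i j n (λ e → nle (P.subst (j ℕ.≤_) e (ℕP.m≤m+n j n)))))
  ... | yes le with n ≟ i ∸ j
  ...   | yes P.refl = reflexive (P.trans (coeff-monomial (i ∸ j) _) (P.sym (BxCoeff-≡ i j n (ℕP.m+[n∸m]≡n le))))
  ...   | no ne = reflexive (P.trans (coeff-monomial-≢ (i ∸ j) _ n ne) (P.sym (BxCoeff-≢ i j n (ne ∘ n≡i∸j))))

  coeff-BxInv : ∀ i j n → coeff R (BxInv R i j) n ≈ BxInvCoeff i j n
  coeff-BxInv i j n with j ≤? i
  ... | no nle = reflexive (P.sym (BxInvCoeff-≢ i j n (λ e → nle (P.subst (j ℕ.≤_) e (ℕP.m≤m+n j n)))))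
  ... | yes le with n ≟ i ∸ j
  ...   | yes P.refl = reflexive (P.trans (coeff-monomial (i ∸ j) _) (P.sym (BxInvCoeff-≡ i j n (ℕP.m+[n∸m]≡n le))))
  ...   | no ne = reflexive (P.trans (coeff-monomial-≢ (i ∸ j) _ n ne) (P.sym (BxInvCoeff-≢ i j n (ne ∘ n≡i∸j))))

  open import Algebra.Properties.Ring PolyRing.ring using () renaming (-‿distribˡ-* to -‿distribˡ-*ᴾ)

  xP : Poly R
  xP = 0# ∷ 1# ∷ []

  negxP : Poly R
  negxP = map (-_) xP

  coeff-x*-zero : ∀ q → coeff R (mulP R xP q) 0 ≈ 0#
  coeff-x*-zero q = trans (coeff-add (map (0# *_) q) _ 0) (trans (+-identityʳ _) (trans (coeff-scale 0# q 0) (zeroˡ _)))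

  coeff-x*-suc : ∀ q n → coeff R (mulP R xP q) (suc n) ≈ coeff R q n
  coeff-x*-suc q n = trans (coeff-add (map (0# *_) q) _ (suc n))
    (trans (+-cong (trans (coeff-scale 0# q (suc n)) (zeroˡ _)) (PolyRing.*-identityˡ q n)) (+-identityˡ _))

  coeff-negx* : ∀ q n → coeff R (mulP R negxP q) n ≈ - coeff R (mulP R xP q) n
  coeff-negx* q n = trans (sym (-‿distribˡ-*ᴾ xP q n)) (coeff-neg (mulP R xP q) n)

  private
    +0-≡ : ∀ {j l} → j ℕ.+ 0 P.≡ l → j P.≡ l
    +0-≡ {j} e = P.trans (P.sym (ℕP.+-identityʳ j)) e

  Bx-pascal : ∀ l j → Bx R (suc l) (suc j) ≈P addP R (mulP R xP (Bx R l (suc j))) (Bx R l j)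
  Bx-pascal l j n = trans (coeff-Bx (suc l) (suc j) n)
    (sym (trans (trans (coeff-add (mulP R xP (Bx R l (suc j))) (Bx R l j) n) (+-congˡ (coeff-Bx l j n))) (coeffwise n)))
    where
    coeffwise : ∀ n → coeff R (mulP R xP (Bx R l (suc j))) n + BxCoeff l j n ≈ BxCoeff (suc l) (suc j) n
    coeffwise zero = constantTerm (j ℕ.+ 0 ≟ l)
      where
      constantTerm : Dec (j ℕ.+ 0 P.≡ l) → coeff R (mulP R xP (Bx R l (suc j))) 0 + BxCoeff l j 0 ≈ BxCoeff (suc l) (suc j) 0
      constantTerm (no ne) = trans (+-cong (coeff-x*-zero (Bx R l (suc j))) (reflexive (BxCoeff-≢ l j 0 ne)))
                    (trans (+-identityˡ 0#) (reflexive (P.sym (BxCoeff-≢ (suc l) (suc j) 0 (ne ∘ ℕP.suc-injective)))))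
      constantTerm (yes e) = constantTerm-diagonal (+0-≡ e) e
        where
        constantTerm-diagonal : ∀ {l} → j P.≡ l → j ℕ.+ 0 P.≡ l → coeff R (mulP R xP (Bx R l (suc j))) 0 + BxCoeff l j 0 ≈ BxCoeff (suc l) (suc j) 0
        constantTerm-diagonal P.refl e = trans (+-cong (coeff-x*-zero (Bx R j (suc j))) (reflexive (BxCoeff-≡ j j 0 e)))
                    (trans (+-identityˡ _) (trans (reflexive (P.cong fromℕ (P.trans (nCn≡1 j) (P.sym (nCn≡1 (suc j))))))
                       (reflexive (P.sym (BxCoeff-≡ (suc j) (suc j) 0 (P.cong suc e))))))
    coeffwise (suc n) = higherTerm (suc (j ℕ.+ n) ≟ l)
      where
      higherTerm : Dec (suc (j ℕ.+ n) P.≡ l) → coeff R (mulP R xP (Bx R l (suc j))) (suc n) + BxCoeff l j (suc n) ≈ BxCoeff (suc l) (suc j) (suc n)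
      higherTerm (no ne) = trans (+-congʳ (trans (coeff-x*-suc (Bx R l (suc j)) n) (coeff-Bx l (suc j) n)))
                    (trans (+-cong (reflexive (BxCoeff-≢ l (suc j) n ne)) (reflexive (BxCoeff-≢ l j (suc n) (ne ∘ P.trans (P.sym (ℕP.+-suc j n))))))
                    (trans (+-identityˡ 0#) (reflexive (P.sym (BxCoeff-≢ (suc l) (suc j) (suc n) (ne ∘ P.trans (P.sym (ℕP.+-suc j n)) ∘ ℕP.suc-injective))))))
      higherTerm (yes e) = trans (+-congʳ (trans (coeff-x*-suc (Bx R l (suc j)) n) (coeff-Bx l (suc j) n)))
                    (trans (+-cong (reflexive (BxCoeff-≡ l (suc j) n e)) (reflexive (BxCoeff-≡ l j (suc n) (P.trans (ℕP.+-suc j n) e))))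
                    (trans (+-comm _ _) (trans (sym (fromℕ-+ (l C j) (l C suc j)))
                    (trans (reflexive (P.cong fromℕ (nCk+nC[k+1]≡[n+1]C[k+1] l j)))
                       (reflexive (P.sym (BxCoeff-≡ (suc l) (suc j) (suc n) (P.cong suc (P.trans (ℕP.+-suc j n) e)))))))))

  Bx-col0 : ∀ l → Bx R (suc l) 0 ≈P mulP R xP (Bx R l 0)
  Bx-col0 l zero = trans (coeff-Bx (suc l) 0 0) (trans (reflexive (BxCoeff-≢ (suc l) 0 0 (λ ()))) (sym (coeff-x*-zero (Bx R l 0))))
  Bx-col0 l (suc n) = trans (coeff-Bx (suc l) 0 (suc n)) (trans (byDegree (n ≟ l))
    (sym (trans (coeff-x*-suc (Bx R l 0) n) (coeff-Bx l 0 n))))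
    where
    byDegree : Dec (n P.≡ l) → BxCoeff (suc l) 0 (suc n) ≈ BxCoeff l 0 n
    byDegree (yes e) = reflexive (P.trans (BxCoeff-≡ (suc l) 0 (suc n) (P.cong suc e)) (P.sym (BxCoeff-≡ l 0 n e)))
    byDegree (no ne) = reflexive (P.trans (BxCoeff-≢ (suc l) 0 (suc n) (ne ∘ ℕP.suc-injective)) (P.sym (BxCoeff-≢ l 0 n ne)))

  BxInv-col0 : ∀ j → BxInv R (suc j) 0 ≈P mulP R negxP (BxInv R j 0)
  BxInv-col0 j zero = trans (coeff-BxInv (suc j) 0 0) (trans (reflexive (BxInvCoeff-≢ (suc j) 0 0 (λ ())))
    (sym (trans (coeff-negx* (BxInv R j 0) 0) (trans (-‿cong (coeff-x*-zero (BxInv R j 0))) -0#≈0#))))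
  BxInv-col0 j (suc n) = trans (coeff-BxInv (suc j) 0 (suc n)) (trans (byDegree (n ≟ j))
    (sym (trans (coeff-negx* (BxInv R j 0) (suc n)) (-‿cong (trans (coeff-x*-suc (BxInv R j 0) n) (coeff-BxInv j 0 n))))))
    where
    byDegree : Dec (n P.≡ j) → BxInvCoeff (suc j) 0 (suc n) ≈ - BxInvCoeff j 0 n
    byDegree (yes e) = trans (reflexive (BxInvCoeff-≡ (suc j) 0 (suc n) (P.cong suc e)))
                  (trans (sym (-‿distribˡ-* _ _)) (-‿cong (reflexive (P.sym (BxInvCoeff-≡ j 0 n e)))))
    byDegree (no ne) = trans (reflexive (BxInvCoeff-≢ (suc j) 0 (suc n) (ne ∘ ℕP.suc-injective)))
                  (trans (sym -0#≈0#) (-‿cong (reflexive (P.sym (BxInvCoeff-≢ j 0 n ne)))))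

  BxInv-pascal : ∀ j i → BxInv R (suc j) (suc i) ≈P addP R (mulP R negxP (BxInv R j (suc i))) (BxInv R j i)
  BxInv-pascal j i n = trans (coeff-BxInv (suc j) (suc i) n)
    (sym (trans (trans (coeff-add (mulP R negxP (BxInv R j (suc i))) (BxInv R j i) n)
       (+-cong (coeff-negx* (BxInv R j (suc i)) n) (coeff-BxInv j i n))) (coeffwise n)))
    where
    coeffwise : ∀ n → - coeff R (mulP R xP (BxInv R j (suc i))) n + BxInvCoeff j i n ≈ BxInvCoeff (suc j) (suc i) n
    coeffwise zero = constantTerm (i ℕ.+ 0 ≟ j)
      where
      constantTerm : Dec (i ℕ.+ 0 P.≡ j) → - coeff R (mulP R xP (BxInv R j (suc i))) 0 + BxInvCoeff j i 0 ≈ BxInvCoeff (suc j) (suc i) 0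
      constantTerm (no ne) = trans (+-cong (trans (-‿cong (coeff-x*-zero (BxInv R j (suc i)))) -0#≈0#) (reflexive (BxInvCoeff-≢ j i 0 ne)))
                    (trans (+-identityˡ 0#) (reflexive (P.sym (BxInvCoeff-≢ (suc j) (suc i) 0 (ne ∘ ℕP.suc-injective)))))
      constantTerm (yes e) = constantTerm-diagonal (+0-≡ e) e
        where
        constantTerm-diagonal : ∀ {j} → i P.≡ j → i ℕ.+ 0 P.≡ j → - coeff R (mulP R xP (BxInv R j (suc i))) 0 + BxInvCoeff j i 0 ≈ BxInvCoeff (suc j) (suc i) 0
        constantTerm-diagonal P.refl e = trans (+-cong (trans (-‿cong (coeff-x*-zero (BxInv R i (suc i)))) -0#≈0#) (reflexive (BxInvCoeff-≡ i i 0 e)))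
                    (trans (+-identityˡ _) (trans (reflexive (P.cong (λ t → sgn 0 * fromℕ t) (P.trans (nCn≡1 i) (P.sym (nCn≡1 (suc i))))))
                       (reflexive (P.sym (BxInvCoeff-≡ (suc i) (suc i) 0 (P.cong suc e))))))
    coeffwise (suc n) = higherTerm (suc (i ℕ.+ n) ≟ j)
      where
      higherTerm : Dec (suc (i ℕ.+ n) P.≡ j) → - coeff R (mulP R xP (BxInv R j (suc i))) (suc n) + BxInvCoeff j i (suc n) ≈ BxInvCoeff (suc j) (suc i) (suc n)
      higherTerm (no ne) = trans (+-congʳ (-‿cong (trans (coeff-x*-suc (BxInv R j (suc i)) n) (coeff-BxInv j (suc i) n))))
                    (trans (+-cong (trans (-‿cong (reflexive (BxInvCoeff-≢ j (suc i) n ne))) -0#≈0#)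
                                   (reflexive (BxInvCoeff-≢ j i (suc n) (ne ∘ P.trans (P.sym (ℕP.+-suc i n))))))
                    (trans (+-identityˡ 0#) (reflexive (P.sym (BxInvCoeff-≢ (suc j) (suc i) (suc n) (ne ∘ P.trans (P.sym (ℕP.+-suc i n)) ∘ ℕP.suc-injective))))))
      higherTerm (yes e) = begin
        - coeff R (mulP R xP (BxInv R j (suc i))) (suc n) + BxInvCoeff j i (suc n)
          ≈⟨ +-cong (-‿cong (trans (coeff-x*-suc (BxInv R j (suc i)) n) (coeff-BxInv j (suc i) n)))
                    (reflexive (BxInvCoeff-≡ j i (suc n) (P.trans (ℕP.+-suc i n) e))) ⟩
        - BxInvCoeff j (suc i) n + (- sgn n) * fromℕ (j C i)
          ≈⟨ +-congʳ (trans (-‿cong (reflexive (BxInvCoeff-≡ j (suc i) n e))) (-‿distribˡ-* _ _)) ⟩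
        (- sgn n) * fromℕ (j C suc i) + (- sgn n) * fromℕ (j C i) ≈⟨ sym (distribˡ _ _ _) ⟩
        (- sgn n) * (fromℕ (j C suc i) + fromℕ (j C i)) ≈⟨ *-congˡ (+-comm _ _) ⟩
        (- sgn n) * (fromℕ (j C i) + fromℕ (j C suc i)) ≈⟨ *-congˡ (sym (fromℕ-+ (j C i) (j C suc i))) ⟩
        (- sgn n) * fromℕ (j C i ℕ.+ j C suc i) ≈⟨ reflexive (P.cong (λ t → (- sgn n) * fromℕ t) (nCk+nC[k+1]≡[n+1]C[k+1] j i)) ⟩
        (- sgn n) * fromℕ (suc j C suc i) ≈⟨ reflexive (P.sym (BxInvCoeff-≡ (suc j) (suc i) (suc n) (P.cong suc (P.trans (ℕP.+-suc i n) e)))) ⟩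
        BxInvCoeff (suc j) (suc i) (suc n) ∎

module BinomialInverse {c ℓ p : Level} (R : POCommRing c ℓ p) where

  module BR = POCommRing R
  open Polynomials R using (polyRingᵂ; wrap; addW-eq; mulW-eq; negW-eq)
  open Binomial R using (Bx-col0; Bx-pascal; BxInv-col0; BxInv-pascal; xP; negxP; Bx-above)
  open CommutativeRing polyRingᵂ hiding (zero)
  open Determinants polyRingᵂ
  open import Relation.Binary.Reasoning.Setoid setoid

  B = Bx R
  Bi = BxInv R

  negx : Poly R
  negx = - xP

  Bx-col0ᵂ : ∀ l → B (suc l) 0 ≈ xP * B l 0
  Bx-col0ᵂ l = trans (wrap (Bx-col0 l)) (reflexive (P.sym (mulW-eq xP (B l 0))))

  Bx-pascalᵂ : ∀ l j → B (suc l) (suc j) ≈ xP * B l (suc j) + B l j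
  Bx-pascalᵂ l j = trans (wrap (Bx-pascal l j)) (reflexive (P.sym (P.trans (addW-eq (xP * B l (suc j)) (B l j))
    (P.cong (λ t → addP R t (B l j)) (mulW-eq xP (B l (suc j)))))))

  negx≡negxP : negx P.≡ negxP
  negx≡negxP = negW-eq xP

  BxInv-col0ᵂ : ∀ j → Bi (suc j) 0 ≈ negx * Bi j 0
  BxInv-col0ᵂ j = trans (wrap (BxInv-col0 j)) (reflexive (P.sym (P.trans (mulW-eq negx (Bi j 0)) (P.cong (λ t → mulP R t (Bi j 0)) negx≡negxP))))

  BxInv-pascalᵂ : ∀ j i → Bi (suc j) (suc i) ≈ negx * Bi j (suc i) + Bi j i
  BxInv-pascalᵂ j i = trans (wrap (BxInv-pascal j i)) (reflexive (P.sym (P.trans (addW-eq (negx * Bi j (suc i)) (Bi j i))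
    (P.cong (λ t → addP R t (Bi j i)) (P.trans (mulW-eq negx (Bi j (suc i))) (P.cong (λ t → mulP R t (Bi j (suc i))) negx≡negxP))))))

  BBi : ℕ → ℕ → Poly R
  BBi l i = sumRange (suc l) (λ j → B l j * Bi j i)

  BBi-suc : ∀ l i → BBi (suc l) i ≈ xP * BBi l i + sumRange (suc l) (λ j → B l j * Bi (suc j) i)
  BBi-suc l i = begin
    BBi (suc l) i ≈⟨ sumRange-sucˡ (suc l) (λ j → B (suc l) j * Bi j i) ⟩
    B (suc l) 0 * Bi 0 i + sumRange (suc l) (λ j → B (suc l) (suc j) * Bi (suc j) i)
      ≈⟨ +-cong (*-congʳ (Bx-col0ᵂ l)) (∑-cong (sumRange-linear (suc l)) {λ j → B (suc l) (suc j) * Bi (suc j) i} {λ j → (xP * B l (suc j) + B l j) * Bi (suc j) i} (λ j → *-congʳ (Bx-pascalᵂ l j))) ⟩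
    (xP * B l 0) * Bi 0 i + sumRange (suc l) (λ j → (xP * B l (suc j) + B l j) * Bi (suc j) i)
      ≈⟨ +-cong (*-assoc _ _ _) (∑-cong (sumRange-linear (suc l)) {λ j → (xP * B l (suc j) + B l j) * Bi (suc j) i} {λ j → xP * (B l (suc j) * Bi (suc j) i) + B l j * Bi (suc j) i} (λ j → trans (distribʳ _ _ _) (+-congʳ (*-assoc _ _ _)))) ⟩
    xP * (B l 0 * Bi 0 i) + sumRange (suc l) (λ j → xP * (B l (suc j) * Bi (suc j) i) + B l j * Bi (suc j) i)
      ≈⟨ +-congˡ (trans (∑-+ (sumRange-linear (suc l)) (λ j → xP * (B l (suc j) * Bi (suc j) i)) (λ j → B l j * Bi (suc j) i))
                   (+-congʳ (sym (*-∑ (sumRange-linear (suc l)) xP (λ j → B l (suc j) * Bi (suc j) i))))) ⟩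
    xP * (B l 0 * Bi 0 i) + (xP * sumRange (suc l) (λ j → B l (suc j) * Bi (suc j) i) + S)
      ≈⟨ trans (sym (+-assoc _ _ _)) (+-congʳ (sym (distribˡ _ _ _))) ⟩
    xP * (B l 0 * Bi 0 i + sumRange (suc l) (λ j → B l (suc j) * Bi (suc j) i)) + S
      ≈⟨ +-congʳ (*-congˡ (sym (sumRange-sucˡ (suc l) (λ j → B l j * Bi j i)))) ⟩
    xP * (BBi l i + B l (suc l) * Bi (suc l) i) + S
      ≈⟨ +-congʳ (*-congˡ (trans (+-congˡ (trans (*-congʳ (reflexive (Bx-above l (suc l) (ℕP.<⇒≱ (ℕP.n<1+n l))))) (zeroˡ _))) (+-identityʳ _))) ⟩
    xP * BBi l i + S ∎
    where
    S = sumRange (suc l) (λ j → B l j * Bi (suc j) i)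

  x+negx≈0 : xP + negx ≈ 0#
  x+negx≈0 = -‿inverseʳ xP

  BBi-suc-zero : ∀ l → BBi (suc l) 0 ≈ 0#
  BBi-suc-zero l = begin
    BBi (suc l) 0 ≈⟨ BBi-suc l 0 ⟩
    xP * BBi l 0 + sumRange (suc l) (λ j → B l j * Bi (suc j) 0)
      ≈⟨ +-congˡ (∑-cong (sumRange-linear (suc l)) {λ j → B l j * Bi (suc j) 0} {λ j → negx * (B l j * Bi j 0)} (λ j → trans (*-congˡ (BxInv-col0ᵂ j)) (CSP.x∙yz≈y∙xz *-commutativeSemigroup _ _ _))) ⟩
    xP * BBi l 0 + sumRange (suc l) (λ j → negx * (B l j * Bi j 0))
      ≈⟨ +-congˡ (sym (*-∑ (sumRange-linear (suc l)) negx (λ j → B l j * Bi j 0))) ⟩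
    xP * BBi l 0 + negx * BBi l 0 ≈⟨ sym (distribʳ _ _ _) ⟩
    (xP + negx) * BBi l 0 ≈⟨ *-congʳ x+negx≈0 ⟩
    0# * BBi l 0 ≈⟨ zeroˡ _ ⟩
    0# ∎
    where import Algebra.Properties.CommutativeSemigroup as CSP

  BBi-suc-suc : ∀ l i → BBi (suc l) (suc i) ≈ BBi l i
  BBi-suc-suc l i = begin
    BBi (suc l) (suc i) ≈⟨ BBi-suc l (suc i) ⟩
    xP * BBi l (suc i) + sumRange (suc l) (λ j → B l j * Bi (suc j) (suc i))
      ≈⟨ +-congˡ (∑-cong (sumRange-linear (suc l)) {λ j → B l j * Bi (suc j) (suc i)} {λ j → negx * (B l j * Bi j (suc i)) + B l j * Bi j i} (λ j → trans (*-congˡ (BxInv-pascalᵂ j i))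
            (trans (distribˡ _ _ _) (+-congʳ (CSP.x∙yz≈y∙xz *-commutativeSemigroup _ _ _))))) ⟩
    xP * BBi l (suc i) + sumRange (suc l) (λ j → negx * (B l j * Bi j (suc i)) + B l j * Bi j i)
      ≈⟨ +-congˡ (trans (∑-+ (sumRange-linear (suc l)) (λ j → negx * (B l j * Bi j (suc i))) (λ j → B l j * Bi j i))
                   (+-congʳ (sym (*-∑ (sumRange-linear (suc l)) negx (λ j → B l j * Bi j (suc i)))))) ⟩
    xP * BBi l (suc i) + (negx * BBi l (suc i) + BBi l i) ≈⟨ sym (+-assoc _ _ _) ⟩
    (xP * BBi l (suc i) + negx * BBi l (suc i)) + BBi l i ≈⟨ +-congʳ (trans (sym (distribʳ _ _ _)) (trans (*-congʳ x+negx≈0) (zeroˡ _))) ⟩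
    0# + BBi l i ≈⟨ +-identityˡ _ ⟩
    BBi l i ∎
    where import Algebra.Properties.CommutativeSemigroup as CSP

  Bx00 : B 0 0 ≈ 1#
  Bx00 = wrap λ { zero → BR.+-identityʳ BR.1# ; (suc n) → BR.refl }

  BxInv00 : Bi 0 0 ≈ 1#
  BxInv00 = wrap λ { zero → BR.trans (BR.*-identityˡ _) (BR.+-identityʳ BR.1#) ; (suc n) → BR.refl }

  BBi-zero : ∀ i → BBi 0 i ≈ δ 0 i
  BBi-zero zero = begin
    0# + B 0 0 * Bi 0 0 ≈⟨ +-identityˡ (B 0 0 * Bi 0 0) ⟩
    B 0 0 * Bi 0 0 ≈⟨ *-cong {B 0 0} {1#} {Bi 0 0} {1#} Bx00 BxInv00 ⟩
    1# * 1# ≈⟨ *-identityˡ 1# ⟩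
    1# ∎
  BBi-zero (suc i) = begin
    0# + B 0 0 * Bi 0 (suc i) ≈⟨ +-identityˡ (B 0 0 * Bi 0 (suc i)) ⟩
    B 0 0 * 0# ≈⟨ zeroʳ (B 0 0) ⟩
    0# ∎

  BBi≈δ : ∀ l i → BBi l i ≈ δ l i
  BBi≈δ zero i = BBi-zero i
  BBi≈δ (suc l) zero = BBi-suc-zero l
  BBi≈δ (suc l) (suc i) = begin
    BBi (suc l) (suc i) ≈⟨ BBi-suc-suc l i ⟩
    BBi l i ≈⟨ BBi≈δ l i ⟩
    δ l i ∎

module RowPolynomials {c ℓ p : Level} (R : POCommRing c ℓ p)
    (P : ℕ → ℕ → POCommRing.Carrier R) (rf : RowFinite R P) where

  open import Data.List using (applyUpTo)
  import Relation.Binary.PropositionalEquality as Eq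

  module BR = POCommRing R
  module BC = Determinants BR.commRing
  open RowFinite rf
  open Polynomials R using (polyRingᵂ; polyPOCommRing; _≈P_; _≈W_; wrap; unwrap; addW-eq; mulW-eq; negW-eq; detᵂ≡det; sumRangeᵂ≡sumRange;
    coeff-add; coeff-scale; NonnegPoly-resp; NonnegPoly-+; NonnegPoly-*; NonnegPoly-1; NonnegPoly⇒coeff; coeff⇒NonnegPoly)
  open Binomial R using (Bx-above; BxInv-above; BxCoeff; BxCoeff-≡; BxCoeff-≢; coeff-Bx)
  open BinomialInverse R using (B; Bi; BBi; BBi≈δ; Bx00)
  open CommutativeRing polyRingᵂ hiding (zero)
  open Determinants polyRingᵂ
  open import Relation.Binary.Reasoning.Setoid setoid

  a : ℕ → ℕ → BR.Carrier
  a = outputMatrix R P rf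

  L : ℕ → ℕ
  L n = powBound R P rf n 0

  Bx-vanishes : ∀ l j → l ℕ.< j → B l j ≈ 0#
  Bx-vanishes l j l<j = reflexive (Bx-above l j (ℕP.<⇒≱ l<j))

  BxInv-vanishes : ∀ l j → l ℕ.< j → Bi l j ≈ 0#
  BxInv-vanishes l j l<j = reflexive (BxInv-above l j (ℕP.<⇒≱ l<j))

  PBx : ℕ → ℕ → Poly R
  PBx i j = sumRange (bound i) (λ l → const R (P i l) * B l j)

  Q : ℕ → ℕ → Poly R
  Q k j = sumRange (suc k) (λ i → Bi k i * PBx i j)

  Q-bound : ℕ → ℕ
  Q-bound k = maxRange R (suc k) bound

  ABx : ℕ → ℕ → Poly R
  ABx n k = sumRange (L n) (λ j → const R (a n j) * B j k)

  -- Qpow₀ m k = (Q^m)ₖ₀.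
  Qpow₀ : ℕ → ℕ → Poly R
  Qpow₀ zero zero = 1#
  Qpow₀ zero (suc k) = 0#
  Qpow₀ (suc m) k = sumRange (Q-bound k) (λ j → Q k j * Qpow₀ m j)

  Q-vanishes : ∀ k j → Q-bound k ℕ.≤ j → Q k j ≈ 0#
  Q-vanishes k j le = sumRange-zero< (suc k) _ (λ i i<k → trans (*-congˡ (sumRange-zero< (bound i) _ (λ l l<b →
    trans (*-congˡ (Bx-vanishes l j (ℕP.<-≤-trans l<b (ℕP.≤-trans (maxRange-≤ R (suc k) bound i i<k) le)))) (zeroʳ _)))) (zeroʳ _))

  ABx-vanishes : ∀ n k → L n ℕ.≤ k → ABx n k ≈ 0#
  ABx-vanishes n k le = sumRange-zero< (L n) _ (λ j j<L → trans (*-congˡ (Bx-vanishes j k (ℕP.<-≤-trans j<L le))) (zeroʳ _))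

  ABx00 : ABx 0 0 ≈ 1#
  ABx00 = trans (+-identityˡ _) (trans (*-congˡ Bx00) (*-identityʳ _))

  ABx0suc : ∀ k → ABx 0 (suc k) ≈ 0#
  ABx0suc k = trans (+-identityˡ _) (trans (*-congˡ (Bx-vanishes 0 (suc k) (ℕ.s≤s ℕ.z≤n))) (zeroʳ _))

  const≈0 : ∀ {x} → x BR.≈ BR.0# → const R x ≈ 0#
  const≈0 e = wrap λ { zero → e ; (suc n) → BR.refl }

  const-* : ∀ x y → const R x * const R y ≈ const R (x BR.* y)
  const-* x y = trans (reflexive (mulW-eq (const R x) (const R y))) (wrap λ { zero → BR.+-identityʳ _ ; (suc n) → BR.refl })

  const-+ : ∀ x y → const R x + const R y ≈ const R (x BR.+ y)
  const-+ x y = reflexive (addW-eq (const R x) (const R y))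

  const-sumRange : ∀ N f → const R (BC.sumRange N f) ≈ sumRange N (λ l → const R (f l))
  const-sumRange zero f = const≈0 BR.refl
  const-sumRange (suc N) f = trans (sym (const-+ _ _)) (+-congʳ (const-sumRange N f))

  BxQ≈PBx : ∀ l k → sumRange (suc l) (λ j → B l j * Q j k) ≈ PBx l k
  BxQ≈PBx l k = begin
    sumRange (suc l) (λ j → B l j * Q j k)
      ≈⟨ sumRange-cong< (suc l) (λ j j<l → *-congˡ (sumRange-pad≤ _ j<l (λ i j<i → trans (*-congʳ (BxInv-vanishes j i j<i)) (zeroˡ _)))) ⟩
    sumRange (suc l) (λ j → B l j * sumRange (suc l) (λ i → Bi j i * PBx i k))
      ≈⟨ ∑-cong (sumRange-linear (suc l)) (λ j → *-∑ (sumRange-linear (suc l)) (B l j) (λ i → Bi j i * PBx i k)) ⟩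
    sumRange (suc l) (λ j → sumRange (suc l) (λ i → B l j * (Bi j i * PBx i k)))
      ≈⟨ sumRange-exchange (suc l) (sumRange-linear (suc l)) (λ j i → B l j * (Bi j i * PBx i k)) ⟩
    sumRange (suc l) (λ i → sumRange (suc l) (λ j → B l j * (Bi j i * PBx i k)))
      ≈⟨ ∑-cong (sumRange-linear (suc l)) (λ i → trans (∑-cong (sumRange-linear (suc l)) (λ j → sym (*-assoc _ _ _)))
            (sym (sumRange-*ʳ (suc l) (λ j → B l j * Bi j i) (PBx i k)))) ⟩
    sumRange (suc l) (λ i → BBi l i * PBx i k)
      ≈⟨ ∑-cong (sumRange-linear (suc l)) (λ i → *-congʳ (BBi≈δ l i)) ⟩
    sumRange (suc l) (λ i → δ l i * PBx i k) ≈⟨ sumRange-δ l (λ i → PBx i k) ⟩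
    PBx l k ∎

  BxQ≈PBx-bounded : ∀ n l k → l ℕ.< L n → sumRange (L n) (λ j → B l j * Q j k) ≈ PBx l k
  BxQ≈PBx-bounded n l k l<L = trans (sym (sumRange-pad≤ _ l<L (λ j l<j → trans (*-congʳ (Bx-vanishes l j l<j)) (zeroˡ _)))) (BxQ≈PBx l k)

  ABx-suc : ∀ n k → ABx (suc n) k ≈ sumRange (L n) (λ j → ABx n j * Q j k)
  ABx-suc n k = sym (begin
    sumRange (L n) (λ j → ABx n j * Q j k)
      ≈⟨ ∑-cong (sumRange-linear (L n)) (λ j → trans (sumRange-*ʳ (L n) (λ l → const R (a n l) * B l j) (Q j k))
            (∑-cong (sumRange-linear (L n)) (λ l → *-assoc _ _ _))) ⟩
    sumRange (L n) (λ j → sumRange (L n) (λ l → const R (a n l) * (B l j * Q j k)))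
      ≈⟨ sumRange-exchange (L n) (sumRange-linear (L n)) (λ j l → const R (a n l) * (B l j * Q j k)) ⟩
    sumRange (L n) (λ l → sumRange (L n) (λ j → const R (a n l) * (B l j * Q j k)))
      ≈⟨ ∑-cong (sumRange-linear (L n)) (λ l → sym (*-∑ (sumRange-linear (L n)) (const R (a n l)) (λ j → B l j * Q j k))) ⟩
    sumRange (L n) (λ l → const R (a n l) * sumRange (L n) (λ j → B l j * Q j k))
      ≈⟨ sumRange-cong< (L n) (λ l l<L → *-congˡ (BxQ≈PBx-bounded n l k l<L)) ⟩
    sumRange (L n) (λ l → const R (a n l) * PBx l k)
      ≈⟨ ∑-cong (sumRange-linear (L n)) (λ l → *-∑ (sumRange-linear (bound l)) (const R (a n l)) (λ m → const R (P l m) * B m k)) ⟩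
    sumRange (L n) (λ l → sumRange (bound l) (λ m → const R (a n l) * (const R (P l m) * B m k)))
      ≈⟨ sumRange-cong< (L n) (λ l l<L → sumRange-pad≤ _ (maxRange-≤ R (L n) bound l l<L)
            (λ m bm → trans (*-congˡ (trans (*-congʳ (const≈0 (vanish l m bm))) (zeroˡ _))) (zeroʳ _))) ⟩
    sumRange (L n) (λ l → sumRange (L (suc n)) (λ m → const R (a n l) * (const R (P l m) * B m k)))
      ≈⟨ sumRange-exchange (L n) (sumRange-linear (L (suc n))) (λ l m → const R (a n l) * (const R (P l m) * B m k)) ⟩
    sumRange (L (suc n)) (λ m → sumRange (L n) (λ l → const R (a n l) * (const R (P l m) * B m k)))
      ≈⟨ ∑-cong (sumRange-linear (L (suc n))) (λ m → trans (∑-cong (sumRange-linear (L n)) (λ l → trans (sym (*-assoc _ _ _)) (*-congʳ (const-* _ _))))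
            (sym (sumRange-*ʳ (L n) (λ l → const R (a n l BR.* P l m)) (B m k)))) ⟩
    sumRange (L (suc n)) (λ m → sumRange (L n) (λ l → const R (a n l BR.* P l m)) * B m k)
      ≈⟨ ∑-cong (sumRange-linear (L (suc n))) (λ m → *-congʳ (sym (const-sumRange (L n) (λ l → a n l BR.* P l m)))) ⟩
    ABx (suc n) k ∎)

  ABx-Hankel : ∀ m n → ABx (n ℕ.+ m) 0 ≈ sumRange (L n) (λ k → ABx n k * Qpow₀ m k)
  ABx-Hankel zero n = sym (begin
    sumRange (L n) (λ k → ABx n k * Qpow₀ 0 k)
      ≈⟨ sumRange-pad≤ _ (ℕP.n≤1+n (L n)) (λ k Lk → trans (*-congʳ (ABx-vanishes n k Lk)) (zeroˡ _)) ⟩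
    sumRange (suc (L n)) (λ k → ABx n k * Qpow₀ 0 k) ≈⟨ sumRange-sucˡ (L n) (λ k → ABx n k * Qpow₀ 0 k) ⟩
    ABx n 0 * 1# + sumRange (L n) (λ k → ABx n (suc k) * 0#)
      ≈⟨ +-cong (*-identityʳ _) (∑-zero (sumRange-linear (L n)) (λ k → ABx n (suc k) * 0#) (λ k → zeroʳ _)) ⟩
    ABx n 0 + 0# ≈⟨ +-identityʳ _ ⟩
    ABx n 0 ≈⟨ reflexive (Eq.cong (λ t → ABx t 0) (Eq.sym (ℕP.+-identityʳ n))) ⟩
    ABx (n ℕ.+ 0) 0 ∎)
  ABx-Hankel (suc m) n = begin
    ABx (n ℕ.+ suc m) 0 ≈⟨ reflexive (Eq.cong (λ t → ABx t 0) (ℕP.+-suc n m)) ⟩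
    ABx (suc n ℕ.+ m) 0 ≈⟨ ABx-Hankel m (suc n) ⟩
    sumRange (L (suc n)) (λ j → ABx (suc n) j * Qpow₀ m j)
      ≈⟨ sumRange-pad≤ _ (ℕP.m≤m⊔n (L (suc n)) (maxRange R (L n) Q-bound)) (λ j Lj → trans (*-congʳ (ABx-vanishes (suc n) j Lj)) (zeroˡ _)) ⟩
    sumRange N' (λ j → ABx (suc n) j * Qpow₀ m j)
      ≈⟨ ∑-cong (sumRange-linear N') (λ j → trans (*-congʳ (ABx-suc n j))
            (trans (sumRange-*ʳ (L n) (λ k → ABx n k * Q k j) (Qpow₀ m j)) (∑-cong (sumRange-linear (L n)) (λ k → *-assoc _ _ _)))) ⟩
    sumRange N' (λ j → sumRange (L n) (λ k → ABx n k * (Q k j * Qpow₀ m j)))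
      ≈⟨ sumRange-exchange N' (sumRange-linear (L n)) (λ j k → ABx n k * (Q k j * Qpow₀ m j)) ⟩
    sumRange (L n) (λ k → sumRange N' (λ j → ABx n k * (Q k j * Qpow₀ m j)))
      ≈⟨ ∑-cong (sumRange-linear (L n)) (λ k → sym (*-∑ (sumRange-linear N') (ABx n k) (λ j → Q k j * Qpow₀ m j))) ⟩
    sumRange (L n) (λ k → ABx n k * sumRange N' (λ j → Q k j * Qpow₀ m j))
      ≈⟨ sumRange-cong< (L n) (λ k k<L → *-congˡ (sym (sumRange-pad≤ _
            (ℕP.≤-trans (maxRange-≤ R (L n) Q-bound k k<L) (ℕP.m≤n⊔m (L (suc n)) (maxRange R (L n) Q-bound)))
            (λ j bj → trans (*-congʳ (Q-vanishes k j bj)) (zeroˡ _))))) ⟩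
    sumRange (L n) (λ k → ABx n k * Qpow₀ (suc m) k) ∎
    where
    N' = L (suc n) ℕ.⊔ maxRange R (L n) Q-bound

  coeff-map-applyUpTo< : ∀ N (g : ℕ → ℕ) (f : ℕ → BR.Carrier) t → t ℕ.< N → coeff R (map f (applyUpTo g N)) t Eq.≡ f (g t)
  coeff-map-applyUpTo< (suc N) g f zero _ = Eq.refl
  coeff-map-applyUpTo< (suc N) g f (suc t) (ℕ.s≤s lt) = coeff-map-applyUpTo< N (g ∘ suc) f t lt

  coeff-map-applyUpTo≥ : ∀ N (g : ℕ → ℕ) (f : ℕ → BR.Carrier) t → N ℕ.≤ t → coeff R (map f (applyUpTo g N)) t Eq.≡ BR.0#
  coeff-map-applyUpTo≥ zero g f t _ = Eq.refl
  coeff-map-applyUpTo≥ (suc N) g f (suc t) (ℕ.s≤s le) = coeff-map-applyUpTo≥ N (g ∘ suc) f t le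

  coeff-sumRange : ∀ N (F : ℕ → Poly R) t → coeff R (sumRange N F) t BR.≈ BC.sumRange N (λ j → coeff R (F j) t)
  coeff-sumRange zero F t = BR.refl
  coeff-sumRange (suc N) F t = BR.trans (BR.reflexive (Eq.cong (λ z → coeff R z t) (addW-eq (sumRange N F) (F N))))
    (BR.trans (coeff-add (sumRange N F) (F N) t) (BR.+-congʳ (coeff-sumRange N F t)))

  coeff-const* : ∀ x q t → coeff R (const R x * q) t BR.≈ x BR.* coeff R q t
  coeff-const* x q t = BR.trans (BR.reflexive (Eq.cong (λ z → coeff R z t) (mulW-eq (const R x) q)))
    (BR.trans (coeff-add (map (x BR.*_) q) (BR.0# ∷ []) t)
    (BR.trans (BR.+-cong (coeff-scale x q t) (c0 t)) (BR.+-identityʳ _)))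
    where
    c0 : ∀ t → coeff R (BR.0# ∷ []) t BR.≈ BR.0#
    c0 zero = BR.refl
    c0 (suc t) = BR.refl

  sum-BxCoeff₀-≥ : ∀ N (f : ℕ → BR.Carrier) t → N ℕ.≤ t → BC.sumRange N (λ j → f j BR.* BxCoeff j 0 t) BR.≈ BR.0#
  sum-BxCoeff₀-≥ zero f t le = BR.refl
  sum-BxCoeff₀-≥ (suc N) f t le = BR.trans (BR.+-cong (sum-BxCoeff₀-≥ N f t (ℕP.<⇒≤ le))
      (BR.trans (BR.*-congˡ (BR.reflexive (BxCoeff-≢ N 0 t (λ e → ℕP.<⇒≢ le (Eq.sym e))))) (BR.zeroʳ _)))
    (BR.+-identityˡ BR.0#)

  sum-BxCoeff₀-< : ∀ N (f : ℕ → BR.Carrier) t → t ℕ.< N → BC.sumRange N (λ j → f j BR.* BxCoeff j 0 t) BR.≈ f t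
  sum-BxCoeff₀-< (suc N) f t lt with ℕP.m≤n⇒m<n∨m≡n (ℕP.≤-pred lt)
  ... | inj₁ t<N = BR.trans (BR.+-cong (sum-BxCoeff₀-< N f t t<N)
      (BR.trans (BR.*-congˡ (BR.reflexive (BxCoeff-≢ N 0 t (λ e → ℕP.<⇒≢ t<N e)))) (BR.zeroʳ _)))
    (BR.+-identityʳ _)
  ... | inj₂ Eq.refl = BR.trans (BR.+-cong (sum-BxCoeff₀-≥ t f t ℕP.≤-refl)
      (BR.trans (BR.*-congˡ (BR.trans (BR.reflexive (BxCoeff-≡ t 0 t Eq.refl)) (BR.+-identityʳ BR.1#))) (BR.*-identityʳ _)))
    (BR.+-identityˡ _)

  rowPoly≈ABx₀ : ∀ n → rowPoly R P rf n ≈ ABx n 0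
  rowPoly≈ABx₀ n = wrap λ t → BR.sym (BR.trans (coeff-sumRange (L n) (λ j → const R (a n j) * B j 0) t)
    (BR.trans (BC.∑-cong (BC.sumRange-linear (L n)) (λ j → BR.trans (coeff-const* (a n j) (B j 0) t) (BR.*-congˡ (coeff-Bx j 0 t))))
    (cmp t)))
    where
    cmp : ∀ t → BC.sumRange (L n) (λ j → a n j BR.* BxCoeff j 0 t) BR.≈ coeff R (rowPoly R P rf n) t
    cmp t with t ℕ.<? L n
    ... | yes lt = BR.trans (sum-BxCoeff₀-< (L n) (a n) t lt) (BR.reflexive (Eq.sym (coeff-map-applyUpTo< (L n) (λ x → x) (a n) t lt)))
    ... | no nlt = BR.trans (sum-BxCoeff₀-≥ (L n) (a n) t (ℕP.≮⇒≥ nlt)) (BR.reflexive (Eq.sym (coeff-map-applyUpTo≥ (L n) (λ x → x) (a n) t (ℕP.≮⇒≥ nlt))))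

  module U = RawOps (polyRawRing R)

  module Pos = Positivity polyPOCommRing
  open POCommRing polyPOCommRing using (Nonneg-resp)

  Q≡conjByBx : ∀ k j → Q k j Eq.≡ conjByBx R P rf k j
  Q≡conjByBx k j = sumRangeᵂ≡sumRange (suc k) _ _ (λ i → Eq.trans (mulW-eq (Bi k i) (PBx i j))
    (Eq.cong (mulP R (Bi k i)) (sumRangeᵂ≡sumRange (bound i) _ _ (λ l → mulW-eq (const R (P i l)) (B l j)))))

  NonnegPoly-detᵂ : ∀ k M → NonnegPoly R (U.det k M) → NonnegPoly R (det k M)
  NonnegPoly-detᵂ k M h = Eq.subst (NonnegPoly R) (Eq.sym (detᵂ≡det k M)) h

  NonnegPoly-det : ∀ k M → NonnegPoly R (det k M) → NonnegPoly R (U.det k M)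
  NonnegPoly-det k M h = Eq.subst (NonnegPoly R) (detᵂ≡det k M) h

  module _ (r : Order) (conj-TP : TP (polyRawRing R) (NonnegPoly R) r (conjByBx R P rf)) where

    Q-TP : TP rawRing (NonnegPoly R) r Q
    Q-TP k k≥1 kr rows cols sR sC = Nonneg-resp (det-cong k (λ a b → reflexive (Eq.sym (Q≡conjByBx (rows a) (cols b)))))
      (NonnegPoly-detᵂ k _ (conj-TP k k≥1 kr rows cols sR sC))

    ABx-TP : TP rawRing (NonnegPoly R) r ABx
    ABx-TP = Pos.RowRecurrence.isTP Q ABx L ABx00 ABx0suc ABx-suc ABx-vanishes r Q-TP

    Qpow₀-transpose-TP : TP rawRing (NonnegPoly R) r (λ k m → Qpow₀ m k)
    Qpow₀-transpose-TP = Pos.ColumnRecurrence.isTP Q Qpow₀ Q-bound refl (λ k → refl) (λ m k → refl) Q-vanishes r Q-TP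

    rowPoly-HankelTP : HankelTP (polyRawRing R) (NonnegPoly R) r (rowPoly R P rf)
    rowPoly-HankelTP k k≥1 kr rows cols sR sC = NonnegPoly-det k _ (Nonneg-resp (sym (det-cong k entry))
        (Pos.det-product-nonneg k Nb ABx (λ l m → Qpow₀ m l) rows cols
          (λ T sT _ → ABx-TP k k≥1 kr rows T sR sT)
          (λ T sT _ → Qpow₀-transpose-TP k k≥1 kr T cols sT sC)))
      where
      Nb = maxFin (λ a → L (rows a))
      entry : ∀ a b → rowPoly R P rf (rows a ℕ.+ cols b) ≈ sumRange Nb (λ l → ABx (rows a) l * Qpow₀ (cols b) l)
      entry a b = trans (rowPoly≈ABx₀ (rows a ℕ.+ cols b)) (trans (ABx-Hankel (cols b) (rows a))
        (sumRange-pad≤ _ (maxFin-≤ (λ a → L (rows a)) a) (λ l Ll → trans (*-congʳ (ABx-vanishes (rows a) l Ll)) (zeroˡ _))))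

proposition2p15 : ∀ {c ℓ p : Level} (R : POCommRing c ℓ p)
    (P : ℕ → ℕ → POCommRing.Carrier R) (rf : RowFinite R P)
    (r : Order) → 1 ≤ᵒ r →
    (TP (POCommRing.rawRing R) (POCommRing.Nonneg R) r P →
    TP (POCommRing.rawRing R) (POCommRing.Nonneg R) r (outputMatrix R P rf))
    × (TP (polyRawRing R) (NonnegPoly R) r (conjByBx R P rf) →
    HankelTP (polyRawRing R) (NonnegPoly R) r (rowPoly R P rf))
proposition2p15 R P rf r _ = OutputMatrix.outputMatrix-TP R P rf r , RowPolynomials.rowPoly-HankelTP R P rf r
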